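{- Let $m$ be a positive integer. Then for every positive integer $n>\dfrac{14.4}{\left(\sqrt[m]{2}-\sqrt[m]{1.5}\right)^m}$ there exist a prime number $r$ and a positive integer $a$ such that $n<r<\frac{3n}{2}<a^m<2n$.
   Context: $\sqrt[m]{x}$ denotes the positive real $m$-th root of a positive real number $x$. All inequalities are strict. -}

module Defs where

open import Data.Nat as ℕ using (ℕ; zero; suc)
open import Data.Rational using (ℚ; 1ℚ; 0ℚ; _*_; _-_; _<_; _/_)
open import Data.Integer using (+_)
open import Data.Product using (∃₂; _×_)

_^ℚ_ : ℚ → ℕ → ℚ
q ^ℚ zero  = 1ℚ
q ^ℚ suc k = q * (q ^ℚ k)

infixr 8 _^ℚ_

ℕ→ℚ : ℕ → ℚ
ℕ→ℚ n = + n / 1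

-- AboveThreshold m n  encodes the real inequality
--     n > 14.4 / (2^(1/m) - 1.5^(1/m))^m ,
-- i.e.  n * (2^(1/m) - 1.5^(1/m))^m > 72/5 ,
-- via rational approximations of the m-th roots: a < 2^(1/m)  (a^m < 2),
-- b > 1.5^(1/m)  (b^m > 3/2), 0 < b < a, and n * (a - b)^m > 72/5.
-- (By density of ℚ and monotonicity of x ↦ x^m on positive reals this is
-- equivalent to the real inequality.)
AboveThreshold : ℕ → ℕ → Set
AboveThreshold m n =
  ∃₂ λ (a b : ℚ) →
    (0ℚ < b) × (b < a) ×
    (a ^ℚ m < ℕ→ℚ 2) ×
    ((+ 3 / 2) < b ^ℚ m) ×
    ((+ 72 / 5) < ℕ→ℚ n * ((a - b) ^ℚ m))

-- A prime r with n < r < 3n/2 exists for every n ≥ 8, and the threshold forces n > 7.2.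
-- Below 53142491 this is read off a ladder of primes, each less than 3/2 times its predecessor.
-- Above it, write n = 2k or 2k + 1 and find a prime in (2k + 1, 3k) by Erdős' argument for
-- C(3k, k): if there were none, Legendre's formula shows that every prime power dividing C(3k, k)
-- divides (T!)^L · primorial(m) · C(k + m, k) · (2k + 1), where m = ⌊k/2⌋, T² > 3k and 2^L > 3k.
-- Indeed prime powers dividing C(3k, k) are at most 3k, primes above √(3k) divide it at most
-- once, and such a prime below 2k + 1 is at most m or divides C(k + m, k).  Comparing
-- 27^k ≤ C(3k, k) 4^k (3k + 1) with primorial(m) ≤ 4^m and C(k + m, k) 2^k ≤ 3^(k + m) gives
-- (27/16)^m ≤ (T!)^L (2k + 1)(3k + 1), which fails once 3k ≥ 4^13.
--
-- For a, take b largest with 2b^m ≤ 3n, so 3n/2 < (b + 1)^m.  The threshold provides rationals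
-- β < α with 3/2 < β^m, α^m < 2 and n (α − β)^m > 1.  Since b^m ≤ nβ^m, the assumption
-- nα^m ≤ (b + 1)^m would give bα ≤ (b + 1)β, i.e. (b + 1)(α − β) ≤ α, and then n (α − β)^m ≤ 1.
-- Hence (b + 1)^m < nα^m < 2n.

module Submission where

open import Defs

module RationalPowers where
  open import Data.Nat as ℕ using (ℕ; zero; suc)
  import Data.Nat.Properties as ℕ
  open import Data.Integer as ℤ using (+_)
  import Data.Integer.Properties as ℤ
  open import Data.Nat.Coprimality using (1-coprimeTo) renaming (sym to coprime-sym)
  open import Data.Product using (_,_)
  open import Data.Rational
  open import Data.Rational.Properties
  open import Data.Rational.Solver using (module +-*-Solver)
  open import Relation.Nullary using (¬_)
  open import Relation.Binary.PropositionalEquality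
  open +-*-Solver

  private
    ℕ→ℚ≡mkℚ : ∀ n → ℕ→ℚ n ≡ mkℚ (+ n) 0 (coprime-sym (1-coprimeTo n))
    ℕ→ℚ≡mkℚ n = normalize-coprime (coprime-sym (1-coprimeTo n))

  ℕ→ℚ-* : ∀ a b → ℕ→ℚ (a ℕ.* b) ≡ ℕ→ℚ a * ℕ→ℚ b
  ℕ→ℚ-* a b = sym (trans (cong₂ _*_ (ℕ→ℚ≡mkℚ a) (ℕ→ℚ≡mkℚ b)) (cong (_/ 1) (sym (ℤ.pos-* a b))))

  ℕ→ℚ-+ : ∀ a b → ℕ→ℚ (a ℕ.+ b) ≡ ℕ→ℚ a + ℕ→ℚ b
  ℕ→ℚ-+ a b = sym (trans (cong₂ _+_ (ℕ→ℚ≡mkℚ a) (ℕ→ℚ≡mkℚ b))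
    (cong (_/ 1) (trans (cong₂ ℤ._+_ (ℤ.*-identityʳ (+ a)) (ℤ.*-identityʳ (+ b))) (sym (ℤ.pos-+ a b)))))

  ℕ→ℚ-suc : ∀ a → ℕ→ℚ (suc a) ≡ ℕ→ℚ a + 1ℚ
  ℕ→ℚ-suc a = trans (cong ℕ→ℚ (ℕ.+-comm 1 a)) (ℕ→ℚ-+ a 1)

  ℕ→ℚ-^ : ∀ a m → ℕ→ℚ (a ℕ.^ m) ≡ ℕ→ℚ a ^ℚ m
  ℕ→ℚ-^ a zero    = refl
  ℕ→ℚ-^ a (suc m) = trans (ℕ→ℚ-* a (a ℕ.^ m)) (cong (ℕ→ℚ a *_) (ℕ→ℚ-^ a m))

  ℕ→ℚ-mono-≤ : ∀ {a b} → a ℕ.≤ b → ℕ→ℚ a ≤ ℕ→ℚ b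
  ℕ→ℚ-mono-≤ {a} {b} a≤b = subst₂ _≤_ (sym (ℕ→ℚ≡mkℚ a)) (sym (ℕ→ℚ≡mkℚ b))
    (*≤* (subst₂ ℤ._≤_ (sym (ℤ.*-identityʳ (+ a))) (sym (ℤ.*-identityʳ (+ b))) (ℤ.+≤+ a≤b)))

  ℕ→ℚ-cancel-< : ∀ {a b} → ℕ→ℚ a < ℕ→ℚ b → a ℕ.< b
  ℕ→ℚ-cancel-< {a} {b} a<b with subst₂ _<_ (ℕ→ℚ≡mkℚ a) (ℕ→ℚ≡mkℚ b) a<b
  ... | *<* a*1<b*1 = ℤ.drop‿+<+ (subst₂ ℤ._<_ (ℤ.*-identityʳ (+ a)) (ℤ.*-identityʳ (+ b)) a*1<b*1)

  *-pres-0≤ : ∀ {x y} → 0ℚ ≤ x → 0ℚ ≤ y → 0ℚ ≤ x * y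
  *-pres-0≤ {x} {y} 0≤x 0≤y = nonNegative⁻¹ (x * y) {{nonNeg*nonNeg⇒nonNeg x {{nonNegative 0≤x}} y {{nonNegative 0≤y}}}}

  ^ℚ-nonNeg : ∀ m {x} → 0ℚ ≤ x → 0ℚ ≤ x ^ℚ m
  ^ℚ-nonNeg zero    _   = *≤* (ℤ.+≤+ ℕ.z≤n)
  ^ℚ-nonNeg (suc m) 0≤x = *-pres-0≤ 0≤x (^ℚ-nonNeg m 0≤x)

  ^ℚ-pos : ∀ m {x} → 0ℚ < x → 0ℚ < x ^ℚ m
  ^ℚ-pos zero    _   = *<* (ℤ.+<+ (ℕ.s≤s ℕ.z≤n))
  ^ℚ-pos (suc m) {x} 0<x = positive⁻¹ _ {{pos*pos⇒pos x {{positive 0<x}} (x ^ℚ m) {{positive (^ℚ-pos m 0<x)}}}}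

  ^ℚ-monoˡ-≤ : ∀ m {x y} → 0ℚ ≤ x → x ≤ y → x ^ℚ m ≤ y ^ℚ m
  ^ℚ-monoˡ-≤ zero    _   _   = ≤-refl
  ^ℚ-monoˡ-≤ (suc m) {x} {y} 0≤x x≤y =
    ≤-trans (*-monoˡ-≤-nonNeg x {{nonNegative 0≤x}} (^ℚ-monoˡ-≤ m 0≤x x≤y))
            (*-monoʳ-≤-nonNeg (y ^ℚ m) {{nonNegative (^ℚ-nonNeg m (≤-trans 0≤x x≤y))}} x≤y)

  ^ℚ-monoˡ-< : ∀ m {x y} → 0ℚ ≤ x → x < y → x ^ℚ suc m < y ^ℚ suc m
  ^ℚ-monoˡ-< m {x} {y} 0≤x x<y =
    ≤-<-trans (*-monoˡ-≤-nonNeg x {{nonNegative 0≤x}} (^ℚ-monoˡ-≤ m 0≤x (<⇒≤ x<y)))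
              (*-monoˡ-<-pos (y ^ℚ m) {{positive (^ℚ-pos m (≤-<-trans 0≤x x<y))}} x<y)

  ^ℚ-distribʳ-* : ∀ m x y → (x * y) ^ℚ m ≡ x ^ℚ m * y ^ℚ m
  ^ℚ-distribʳ-* zero    x y = refl
  ^ℚ-distribʳ-* (suc m) x y = trans (cong ((x * y) *_) (^ℚ-distribʳ-* m x y))
    (solve 4 (λ x y a b → (x :* y) :* (a :* b) := (x :* a) :* (y :* b)) refl x y (x ^ℚ m) (y ^ℚ m))

  private
    0≤ℕ→ℚ : ∀ n → 0ℚ ≤ ℕ→ℚ n
    0≤ℕ→ℚ n = ℕ→ℚ-mono-≤ {0} {n} ℕ.z≤n

    0≤α-β : ∀ {α β} → β < α → 0ℚ ≤ α - β
    0≤α-β {α} {β} β<α = subst (_≤ α - β) (+-inverseʳ β) (+-monoˡ-≤ (- β) (<⇒≤ β<α))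

  consecutive-powers : ∀ m {ν α β B} → 0ℚ < β → β < α → 1ℚ < ν * (α - β) ^ℚ suc m → 0ℚ ≤ B →
                       B ^ℚ suc m ≤ ν * β ^ℚ suc m → (B + 1ℚ) ^ℚ suc m < ν * α ^ℚ suc m
  consecutive-powers m {ν} {α} {β} {B} 0<β β<α 1<νd^M 0≤B B^M≤νβ^M = ≰⇒> ¬να^M≤A^M
    where
    M = suc m
    A = B + 1ℚ
    d = α - β
    0<α : 0ℚ < α
    0<α = <-trans 0<β β<α
    0≤d : 0ℚ ≤ d
    0≤d = 0≤α-β β<α
    0≤A : 0ℚ ≤ A
    0≤A = ≤-trans 0≤B (subst (_≤ A) (+-identityʳ B) (+-monoʳ-≤ B (*≤* (ℤ.+≤+ ℕ.z≤n))))
    nonNeg^M : ∀ {x} → 0ℚ ≤ x → NonNegative (x ^ℚ M)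
    nonNeg^M 0≤x = nonNegative (^ℚ-nonNeg M 0≤x)

    ¬να^M≤A^M : ¬ (ν * α ^ℚ M ≤ A ^ℚ M)
    ¬να^M≤A^M να^M≤A^M = <-irrefl refl (<-≤-trans α^M<α^M*νd^M α^M*νd^M≤α^M)
      where
      open ≤-Reasoning
      [Bα]^M≤[Aβ]^M : (B * α) ^ℚ M ≤ (A * β) ^ℚ M
      [Bα]^M≤[Aβ]^M = begin
        (B * α) ^ℚ M              ≡⟨ ^ℚ-distribʳ-* M B α ⟩
        B ^ℚ M * α ^ℚ M           ≤⟨ *-monoʳ-≤-nonNeg (α ^ℚ M) {{nonNeg^M (<⇒≤ 0<α)}} B^M≤νβ^M ⟩
        ν * β ^ℚ M * α ^ℚ M       ≡⟨ solve 3 (λ ν b a → ν :* b :* a := ν :* a :* b) refl ν (β ^ℚ M) (α ^ℚ M) ⟩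
        ν * α ^ℚ M * β ^ℚ M       ≤⟨ *-monoʳ-≤-nonNeg (β ^ℚ M) {{nonNeg^M (<⇒≤ 0<β)}} να^M≤A^M ⟩
        A ^ℚ M * β ^ℚ M           ≡⟨ ^ℚ-distribʳ-* M A β ⟨
        (A * β) ^ℚ M              ∎
      Bα≤Aβ : B * α ≤ A * β
      Bα≤Aβ = ≮⇒≥ λ Aβ<Bα → <-irrefl refl (<-≤-trans (^ℚ-monoˡ-< m (*-pres-0≤ 0≤A (<⇒≤ 0<β)) Aβ<Bα) [Bα]^M≤[Aβ]^M)
      Ad≤α : A * d ≤ α
      Ad≤α = begin
        A * d
          ≡⟨ solve 3 (λ B α β → (B :+ con 1ℚ) :* (α :- β) := α :+ (B :* α :- (B :+ con 1ℚ) :* β)) refl B α β ⟩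
        α + (B * α - A * β)
          ≤⟨ +-monoʳ-≤ α (subst (B * α - A * β ≤_) (+-inverseʳ (A * β)) (+-monoˡ-≤ (- (A * β)) Bα≤Aβ)) ⟩
        α + 0ℚ                    ≡⟨ +-identityʳ α ⟩
        α                         ∎
      α^M*νd^M≤α^M : α ^ℚ M * (ν * d ^ℚ M) ≤ α ^ℚ M
      α^M*νd^M≤α^M = begin
        α ^ℚ M * (ν * d ^ℚ M)     ≡⟨ solve 3 (λ a ν e → a :* (ν :* e) := ν :* a :* e) refl (α ^ℚ M) ν (d ^ℚ M) ⟩
        ν * α ^ℚ M * d ^ℚ M       ≤⟨ *-monoʳ-≤-nonNeg (d ^ℚ M) {{nonNeg^M 0≤d}} να^M≤A^M ⟩
        A ^ℚ M * d ^ℚ M           ≡⟨ ^ℚ-distribʳ-* M A d ⟨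
        (A * d) ^ℚ M              ≤⟨ ^ℚ-monoˡ-≤ M (*-pres-0≤ 0≤A 0≤d) Ad≤α ⟩
        α ^ℚ M                    ∎
      α^M<α^M*νd^M : α ^ℚ M < α ^ℚ M * (ν * d ^ℚ M)
      α^M<α^M*νd^M = subst (_< α ^ℚ M * (ν * d ^ℚ M)) (*-identityʳ (α ^ℚ M))
                       (*-monoʳ-<-pos (α ^ℚ M) {{positive (^ℚ-pos M 0<α)}} 1<νd^M)

  above-threshold⇒8≤n : ∀ m n → AboveThreshold (suc m) n → 8 ℕ.≤ n
  above-threshold⇒8≤n m n (α , β , 0<β , β<α , α^M<2 , _ , 72/5<νd^M) = ℕ.≮⇒≥ λ n<8 →
    <-irrefl refl (<-≤-trans 72/5<νd^M (begin
      ℕ→ℚ n * d ^ℚ M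
        ≤⟨ *-monoʳ-≤-nonNeg (d ^ℚ M) {{nonNegative (^ℚ-nonNeg M 0≤d)}} (ℕ→ℚ-mono-≤ (ℕ.s≤s⁻¹ n<8)) ⟩
      ℕ→ℚ 7 * d ^ℚ M        ≤⟨ *-monoˡ-≤-nonNeg (ℕ→ℚ 7) {{nonNegative (0≤ℕ→ℚ 7)}} (<⇒≤ d^M<2) ⟩
      ℕ→ℚ 7 * ℕ→ℚ 2         ≤⟨ *≤* (ℤ.+≤+ (ℕ.≤ᵇ⇒≤ 70 72 _)) ⟩
      + 72 / 5              ∎))
    where
    open ≤-Reasoning
    M = suc m
    d = α - β
    0≤d = 0≤α-β β<α
    d≤α : d ≤ α
    d≤α = subst₂ _≤_ (+-identityˡ d) (solve 2 (λ α β → β :+ (α :- β) := α) refl α β) (+-monoˡ-≤ d (<⇒≤ 0<β))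
    d^M<2 : d ^ℚ M < ℕ→ℚ 2
    d^M<2 = ≤-<-trans (^ℚ-monoˡ-≤ M 0≤d d≤α) α^M<2

  above-threshold⇒successor-power<2n : ∀ m n → AboveThreshold (suc m) n →
    ∀ b → 2 ℕ.* b ℕ.^ suc m ℕ.≤ 3 ℕ.* n → suc b ℕ.^ suc m ℕ.< 2 ℕ.* n
  above-threshold⇒successor-power<2n m n (α , β , 0<β , β<α , α^M<2 , 3/2<β^M , 72/5<νd^M) b 2b^M≤3n =
    ℕ→ℚ-cancel-< {suc b ℕ.^ suc m} {2 ℕ.* n} (begin-strict
      ℕ→ℚ (suc b ℕ.^ M)            ≡⟨ trans (ℕ→ℚ-^ (suc b) M) (cong (_^ℚ M) (ℕ→ℚ-suc b)) ⟩
      (B + 1ℚ) ^ℚ M                <⟨ consecutive-powers m {ν} {α} {β} {B} 0<β β<α 1<νd^M (0≤ℕ→ℚ b) B^M≤νβ^M ⟩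
      ν * α ^ℚ M                   ≤⟨ *-monoˡ-≤-nonNeg ν {{nonNegative (0≤ℕ→ℚ n)}} (<⇒≤ α^M<2) ⟩
      ν * ℕ→ℚ 2                    ≡⟨ ℕ→ℚ-* n 2 ⟨
      ℕ→ℚ (n ℕ.* 2)                ≡⟨ cong ℕ→ℚ (ℕ.*-comm n 2) ⟩
      ℕ→ℚ (2 ℕ.* n)                ∎)
    where
    open ≤-Reasoning
    M = suc m
    B = ℕ→ℚ b
    ν = ℕ→ℚ n
    1<νd^M : 1ℚ < ν * (α - β) ^ℚ M
    1<νd^M = <-trans (*<* (ℤ.+<+ (ℕ.≤ᵇ⇒≤ 6 72 _))) 72/5<νd^M
    B^M≤νβ^M : B ^ℚ M ≤ ν * β ^ℚ M
    B^M≤νβ^M = *-cancelˡ-≤-pos (ℕ→ℚ 2) (begin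
      ℕ→ℚ 2 * B ^ℚ M               ≡⟨ trans (ℕ→ℚ-* 2 (b ℕ.^ M)) (cong (ℕ→ℚ 2 *_) (ℕ→ℚ-^ b M)) ⟨
      ℕ→ℚ (2 ℕ.* b ℕ.^ M)          ≤⟨ ℕ→ℚ-mono-≤ 2b^M≤3n ⟩
      ℕ→ℚ (3 ℕ.* n)                ≡⟨ ℕ→ℚ-* 3 n ⟩
      ℕ→ℚ 2 * (+ 3 / 2) * ν        ≡⟨ solve 3 (λ t h ν → t :* h :* ν := t :* (ν :* h)) refl (ℕ→ℚ 2) (+ 3 / 2) ν ⟩
      ℕ→ℚ 2 * (ν * (+ 3 / 2))
        ≤⟨ *-monoˡ-≤-nonNeg (ℕ→ℚ 2) (*-monoˡ-≤-nonNeg ν {{nonNegative (0≤ℕ→ℚ n)}} (<⇒≤ 3/2<β^M)) ⟩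
      ℕ→ℚ 2 * (ν * β ^ℚ M)         ∎)

open RationalPowers using (above-threshold⇒8≤n; above-threshold⇒successor-power<2n)

open import Data.Bool using (Bool; true; false; T; _∧_)
open import Data.Bool.Properties using (T-∧)
open import Data.Empty using (⊥; ⊥-elim)
open import Data.List using (List; []; _∷_)
open import Data.List.Relation.Unary.All using (_∷_)
open import Data.Nat
open import Data.Nat.DivMod using (m≡m%n+[m/n]*n; m%n<n)
open import Data.Nat.Divisibility
open import Data.Nat.Induction using (<-wellFounded)
open import Data.Nat.ListAction using (product)
open import Data.Nat.Primality
open import Data.Nat.Primality.Factorisation using (factorise)
open import Data.Nat.Properties
open import Data.Nat.Tactic.RingSolver using (solve-∀)
open import Data.Product using (∃-syntax; ∃₂; _×_; _,_; proj₁; proj₂)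
open import Data.Sum using (_⊎_; inj₁; inj₂; [_,_]′)
open import Data.Unit using (tt)
open import Function.Bundles using (Equivalence)
open import Induction.WellFounded using (Acc; acc)
open import Relation.Nullary using (Dec; yes; no; ¬_; contradiction)
open import Relation.Nullary.Decidable using (_×-dec_)
open import Relation.Unary using (Decidable)
open import Relation.Binary.PropositionalEquality
open import Algebra.Properties.CommutativeSemigroup *-commutativeSemigroup
  using (interchange; x∙yz≈y∙xz; x∙yz≈z∙xy)
open import Algebra.Properties.CommutativeSemigroup +-commutativeSemigroup
  using () renaming (interchange to +-interchange)

sumTo : ℕ → (ℕ → ℕ) → ℕ
sumTo zero    f = 0
sumTo (suc F) f = f (suc F) + sumTo F f

sumTo-+ : ∀ F f g → sumTo F (λ j → f j + g j) ≡ sumTo F f + sumTo F g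
sumTo-+ zero    f g = refl
sumTo-+ (suc F) f g = begin
  f (suc F) + g (suc F) + sumTo F (λ j → f j + g j) ≡⟨ cong (f (suc F) + g (suc F) +_) (sumTo-+ F f g) ⟩
  f (suc F) + g (suc F) + (sumTo F f + sumTo F g)   ≡⟨ +-interchange (f (suc F)) (g (suc F)) (sumTo F f) (sumTo F g) ⟩
  f (suc F) + sumTo F f + (g (suc F) + sumTo F g)   ∎
  where
  open ≡-Reasoning

sumTo-mono-≤ : ∀ F {f g} → (∀ j → f j ≤ g j) → sumTo F f ≤ sumTo F g
sumTo-mono-≤ zero    f≤g = z≤n
sumTo-mono-≤ (suc F) f≤g = +-mono-≤ (f≤g (suc F)) (sumTo-mono-≤ F f≤g)

sumTo-≤-length : ∀ F f → (∀ j → f j ≤ 1) → sumTo F f ≤ F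
sumTo-≤-length zero    f f≤1 = z≤n
sumTo-≤-length (suc F) f f≤1 = +-mono-≤ (f≤1 (suc F)) (sumTo-≤-length F f f≤1)

sumTo-zero : ∀ F → sumTo F (λ _ → 0) ≡ 0
sumTo-zero zero    = refl
sumTo-zero (suc F) = sumTo-zero F

𝟙 : {P : Set} → Dec P → ℕ
𝟙 (yes _) = 1
𝟙 (no  _) = 0

𝟙-yes : {P : Set} (P? : Dec P) → P → 𝟙 P? ≡ 1
𝟙-yes (yes _)  _  = refl
𝟙-yes (no ¬px) px = contradiction px ¬px

𝟙-no : {P : Set} (P? : Dec P) → ¬ P → 𝟙 P? ≡ 0
𝟙-no (yes px) ¬px = contradiction px ¬px
𝟙-no (no _)   _   = refl

𝟙≤1 : {P : Set} (P? : Dec P) → 𝟙 P? ≤ 1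
𝟙≤1 (yes _) = ≤-refl
𝟙≤1 (no _)  = z≤n

-- Counting the multiples of q in 1‥N makes Legendre's formula an induction on N.
⌊_/_⌋ : ℕ → ℕ → ℕ
⌊ zero  / q ⌋ = 0
⌊ suc N / q ⌋ = 𝟙 (q ∣? suc N) + ⌊ N / q ⌋

⌊/⌋-spec : ∀ N q .{{_ : NonZero q}} → ⌊ N / q ⌋ * q ≤ N × N < suc ⌊ N / q ⌋ * q
⌊/⌋-spec zero    q = z≤n , ≤-trans (>-nonZero⁻¹ q) (m≤m+n q 0)
⌊/⌋-spec (suc N) q with q ∣? suc N | ⌊/⌋-spec N q
... | no q∤1+N | t*q≤N , N<[1+t]*q =
  m≤n⇒m≤1+n t*q≤N , ≤∧≢⇒< N<[1+t]*q (λ eq → q∤1+N (divides (suc ⌊ N / q ⌋) eq))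
... | yes (divides c 1+N≡c*q) | t*q≤N , N<[1+t]*q =
  ≤-reflexive (sym 1+N≡[1+t]*q) , subst (_< suc (suc t) * q) (sym 1+N≡[1+t]*q) (m<n+m (suc t * q) (>-nonZero⁻¹ q))
  where
  t = ⌊ N / q ⌋
  t<c : t < c
  t<c = *-cancelʳ-< q t c (≤-<-trans t*q≤N (subst (N <_) 1+N≡c*q (n<1+n N)))
  1+N≡[1+t]*q : suc N ≡ suc t * q
  1+N≡[1+t]*q = ≤-antisym N<[1+t]*q (subst (suc t * q ≤_) (sym 1+N≡c*q) (*-monoˡ-≤ q t<c))

≤⌊/⌋ : ∀ {t N q} .{{_ : NonZero q}} → t * q ≤ N → t ≤ ⌊ N / q ⌋
≤⌊/⌋ {t} {N} {q} t*q≤N = s≤s⁻¹ (*-cancelʳ-< q t (suc ⌊ N / q ⌋) (≤-<-trans t*q≤N (proj₂ (⌊/⌋-spec N q))))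

⌊/⌋≤ : ∀ {s N q} .{{_ : NonZero q}} → N < suc s * q → ⌊ N / q ⌋ ≤ s
⌊/⌋≤ {s} {N} {q} N<[1+s]*q = s≤s⁻¹ (*-cancelʳ-< q ⌊ N / q ⌋ (suc s) (≤-<-trans (proj₁ (⌊/⌋-spec N q)) N<[1+s]*q))

⌊/⌋≡0 : ∀ {N q} .{{_ : NonZero q}} → N < q → ⌊ N / q ⌋ ≡ 0
⌊/⌋≡0 {N} {q} N<q = n≤0⇒n≡0 (⌊/⌋≤ (subst (N <_) (sym (+-identityʳ q)) N<q))

⌊/⌋>0 : ∀ {N q} .{{_ : NonZero q}} → q ≤ N → 0 < ⌊ N / q ⌋
⌊/⌋>0 {N} {q} q≤N = ≤⌊/⌋ (subst (_≤ N) (sym (*-identityˡ q)) q≤N)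

⌊+/⌋≤ : ∀ a b q .{{_ : NonZero q}} → ⌊ a + b / q ⌋ ≤ suc (⌊ a / q ⌋ + ⌊ b / q ⌋)
⌊+/⌋≤ a b q = ⌊/⌋≤ (subst (a + b <_) (distrib ⌊ a / q ⌋ ⌊ b / q ⌋ q)
  (+-mono-<-≤ (proj₂ (⌊/⌋-spec a q)) (<⇒≤ (proj₂ (⌊/⌋-spec b q)))))
  where
  distrib : ∀ x y q → suc x * q + suc y * q ≡ suc (suc (x + y)) * q
  distrib = solve-∀

⌊+/⌋≤-𝟙 : ∀ a b q .{{_ : NonZero q}} → ⌊ a + b / q ⌋ ≤ ⌊ a / q ⌋ + ⌊ b / q ⌋ + 𝟙 (q ≤? a + b)
⌊+/⌋≤-𝟙 a b q with q ≤? a + b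
... | yes _     = subst (⌊ a + b / q ⌋ ≤_) (+-comm 1 _) (⌊+/⌋≤ a b q)
... | no  q≰a+b = subst (_≤ ⌊ a / q ⌋ + ⌊ b / q ⌋ + 0) (sym (⌊/⌋≡0 (≰⇒> q≰a+b))) z≤n

-- Binomial coefficients and Legendre's formula

-- binom k l is C(k + l, k).
binom : ℕ → ℕ → ℕ
binom zero    l       = 1
binom (suc k) zero    = 1
binom (suc k) (suc l) = binom k (suc l) + binom (suc k) l

binom>0 : ∀ k l → binom k l > 0
binom>0 zero    l       = z<s
binom>0 (suc k) zero    = z<s
binom>0 (suc k) (suc l) = ≤-trans (binom>0 k (suc l)) (m≤m+n _ _)

binom-! : ∀ k l → binom k l * (k ! * l !) ≡ (k + l) !
binom-! zero    l       = trans (*-identityˡ _) (+-identityʳ _)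
binom-! (suc k) zero    = trans (*-identityˡ _) (trans (*-identityʳ _) (cong _! (sym (+-identityʳ (suc k)))))
binom-! (suc k) (suc l) = begin
  (A + B) * (suc k ! * suc l !)                           ≡⟨ pascal A B (k !) (l !) k l ⟩
  suc k * (A * (k ! * suc l !)) + suc l * (B * (suc k ! * l !))
                                                           ≡⟨ cong₂ (λ x y → suc k * x + suc l * y) (binom-! k (suc l)) (binom-! (suc k) l) ⟩
  suc k * (k + suc l) ! + suc l * (suc k + l) !            ≡⟨ cong (λ z → suc k * (k + suc l) ! + suc l * z !) (sym (+-suc k l)) ⟩
  suc k * (k + suc l) ! + suc l * (k + suc l) !            ≡⟨ *-distribʳ-+ ((k + suc l) !) (suc k) (suc l) ⟨
  (suc k + suc l) !                                        ∎
  where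
  open ≡-Reasoning
  A = binom k (suc l)
  B = binom (suc k) l
  pascal : ∀ A B x y k l → (A + B) * ((suc k * x) * (suc l * y))
                         ≡ suc k * (A * (x * (suc l * y))) + suc l * (B * ((suc k * x) * y))
  pascal = solve-∀

^-distribʳ-* : ∀ a b n → (a * b) ^ n ≡ a ^ n * b ^ n
^-distribʳ-* a b zero    = refl
^-distribʳ-* a b (suc n) = trans (cong (a * b *_) (^-distribʳ-* a b n)) (interchange a b (a ^ n) (b ^ n))

^-monoʳ-∣ : ∀ b {i j} → i ≤ j → b ^ i ∣ b ^ j
^-monoʳ-∣ b {i} i≤j with m≤n⇒∃[o]m+o≡n i≤j
... | o , refl = divides (b ^ o) (trans (^-distribˡ-+-* b i o) (*-comm (b ^ i) (b ^ o)))

^-monoˡ-∣ : ∀ {a b} e → a ∣ b → a ^ e ∣ b ^ e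
^-monoˡ-∣ zero    _   = ∣-refl
^-monoˡ-∣ (suc e) a∣b = *-pres-∣ a∣b (^-monoˡ-∣ e a∣b)

n<m^n : ∀ {m} → 1 < m → ∀ n → n < m ^ n
n<m^n 1<m zero    = z<s
n<m^n {m} 1<m (suc n) = begin-strict
  suc n         ≤⟨ n<m^n 1<m n ⟩
  m ^ n         <⟨ m<m+n (m ^ n) (≤-trans z<s (n<m^n 1<m n)) ⟩
  m ^ n + m ^ n ≡⟨ cong (m ^ n +_) (+-identityʳ (m ^ n)) ⟨
  2 * m ^ n     ≤⟨ *-monoˡ-≤ (m ^ n) 1<m ⟩
  m ^ suc n     ∎
  where open ≤-Reasoning

halve : ∀ n → ∃[ m ] (n ≡ 2 * m ⊎ n ≡ suc (2 * m))
halve zero    = 0 , inj₁ refl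
halve (suc n) with halve n
... | m , inj₁ n≡2m   = m , inj₂ (cong suc n≡2m)
... | m , inj₂ n≡1+2m = suc m , inj₁ (trans (cong suc n≡1+2m) (sym (2[1+m]≡2+2m m)))
  where
  2[1+m]≡2+2m : ∀ m → 2 * suc m ≡ suc (suc (2 * m))
  2[1+m]≡2+2m = solve-∀

halving-bounds : ∀ {n m} → n ≡ 2 * m ⊎ n ≡ suc (2 * m) → 2 * m ≤ n × n ≤ suc (2 * m)
halving-bounds (inj₁ refl) = ≤-refl , n≤1+n _
halving-bounds (inj₂ refl) = n≤1+n _ , ≤-refl

2*-half : ∀ {x y} → 2 * x ≤ suc (2 * y) → x ≤ y
2*-half {x} {y} 2x≤1+2y = s≤s⁻¹ (*-cancelˡ-< 2 x (suc y) (≤-<-trans 2x≤1+2y (≤-reflexive (double-suc y))))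
  where
  double-suc : ∀ y → suc (suc (2 * y)) ≡ 2 * suc y
  double-suc = solve-∀

crossing : ∀ {P : ℕ → Set} → Decidable P → P 0 → ∀ n → ¬ P n → ∃[ b ] P b × ¬ P (suc b)
crossing P? P0 zero    ¬P0     = contradiction P0 ¬P0
crossing P? P0 (suc n) ¬P[1+n] with P? n
... | yes Pn  = n , Pn , ¬P[1+n]
... | no  ¬Pn = crossing P? P0 n ¬Pn

n<2*n^[1+m] : ∀ {n} m → 0 < n → n < 2 * n ^ suc m
n<2*n^[1+m] {n} m 0<n = <-≤-trans (m<m+n n 0<n) (+-mono-≤ n≤n^[1+m] (≤-trans n≤n^[1+m] (m≤m+n _ 0)))
  where
  n≤n^[1+m] : n ≤ n ^ suc m
  n≤n^[1+m] = m≤m*n n (n ^ m) {{m^n≢0 n m {{>-nonZero 0<n}}}}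

legendreSum : ℕ → ℕ → ℕ → ℕ
legendreSum p F N = sumTo F (λ j → ⌊ N / p ^ j ⌋)

module _ {p : ℕ} (p-prime : Prime p) where
  private instance
    p≢0 : NonZero p
    p≢0 = prime⇒nonZero p-prime

  prime>1 : 1 < p
  prime>1 = nonTrivial⇒n>1 p {{prime⇒nonTrivial p-prime}}

  prime∤1 : ¬ p ∣ 1
  prime∤1 p∣1 = <⇒≢ prime>1 (sym (∣1⇒≡1 p∣1))

  p^∣p^*u⇒≤ : ∀ {s a u} → p ^ s ∣ p ^ a * u → ¬ p ∣ u → s ≤ a
  p^∣p^*u⇒≤ {s} {a} {u} p^s∣p^a*u p∤u with s ≤? a
  ... | yes s≤a = s≤a
  ... | no  s≰a = contradiction (*-cancelˡ-∣ (p ^ a) {{m^n≢0 p a}} p^a*p∣p^a*u) p∤u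
    where
    p^a*p∣p^a*u : p ^ a * p ∣ p ^ a * u
    p^a*p∣p^a*u = subst (_∣ p ^ a * u) (*-comm p (p ^ a)) (∣-trans (^-monoʳ-∣ p (≰⇒> s≰a)) p^s∣p^a*u)

  factorOut : ∀ x .{{_ : NonZero x}} → ∃[ v ] ∃[ w ] x ≡ p ^ v * w × ¬ p ∣ w
  factorOut x = go x (<-wellFounded x)
    where
    go : ∀ x .{{_ : NonZero x}} → Acc _<_ x → ∃[ v ] ∃[ w ] x ≡ p ^ v * w × ¬ p ∣ w
    go x (acc rec) with p ∣? x
    ... | no p∤x = 0 , x , sym (+-identityʳ x) , p∤x
    ... | yes (divides c x≡c*p) with go c {{c≢0}} (rec c<x)
      where
      instance
        c≢0 : NonZero c
        c≢0 = ≢-nonZero (λ c≡0 → ≢-nonZero⁻¹ x (trans x≡c*p (cong (_* p) c≡0)))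
      c<x : c < x
      c<x = subst (c <_) (sym x≡c*p) (m<m*n c p prime>1)
    ...   | v , w , c≡p^v*w , p∤w = suc v , w , trans x≡c*p (trans (cong (_* p) c≡p^v*w) (rotate (p ^ v) w p)) , p∤w
      where
      rotate : ∀ a b c → a * b * c ≡ c * a * b
      rotate = solve-∀

  powersDividing : ℕ → ℕ → ℕ
  powersDividing F x = sumTo F (λ j → 𝟙 (p ^ j ∣? x))

  powersDividing-≡F : ∀ v w F → F ≤ v → powersDividing F (p ^ v * w) ≡ F
  powersDividing-≡F v w zero    _     = refl
  powersDividing-≡F v w (suc F) 1+F≤v =
    cong₂ _+_ (𝟙-yes _ (∣-trans (^-monoʳ-∣ p 1+F≤v) (m∣m*n w)))
              (powersDividing-≡F v w F (≤-trans (n≤1+n F) 1+F≤v))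

  powersDividing-≡v : ∀ {v w} → ¬ p ∣ w → ∀ F → v ≤ F → powersDividing F (p ^ v * w) ≡ v
  powersDividing-≡v {v} {w} p∤w F v≤F with m≤n⇒m<n∨m≡n v≤F
  ... | inj₂ refl = powersDividing-≡F v w F ≤-refl
  powersDividing-≡v {v} {w} p∤w (suc F) _ | inj₁ v<1+F =
    cong₂ _+_ (𝟙-no _ (λ p^[1+F]∣p^v*w → <⇒≱ v<1+F (p^∣p^*u⇒≤ p^[1+F]∣p^v*w p∤w)))
              (powersDividing-≡v p∤w F (s≤s⁻¹ v<1+F))

  legendre : ∀ F N → N < p ^ F → ∃[ u ] N ! ≡ p ^ legendreSum p F N * u × ¬ p ∣ u
  legendre F zero    _ = 1 , cong (λ z → p ^ z * 1) (sym (sumTo-zero F)) , prime∤1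
  legendre F (suc N) 1+N<p^F with factorOut (suc N) | legendre F N (<-trans (n<1+n N) 1+N<p^F)
  ... | v , w , 1+N≡p^v*w , p∤w | u , N!≡p^L*u , p∤u = w * u , 1+N!≡ , p∤w*u
    where
    L = legendreSum p F N
    v<F : v < F
    v<F = ≰⇒> λ F≤v → <⇒≱ 1+N<p^F (≤-trans (^-monoʳ-≤ p F≤v)
            (∣⇒≤ (divides w (trans 1+N≡p^v*w (*-comm (p ^ v) w)))))
    legendreSum-suc : legendreSum p F (suc N) ≡ v + L
    legendreSum-suc = begin
      legendreSum p F (suc N)                 ≡⟨ sumTo-+ F (λ j → 𝟙 (p ^ j ∣? suc N)) (λ j → ⌊ N / p ^ j ⌋) ⟩
      powersDividing F (suc N) + L            ≡⟨ cong (λ x → powersDividing F x + L) 1+N≡p^v*w ⟩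
      powersDividing F (p ^ v * w) + L        ≡⟨ cong (_+ L) (powersDividing-≡v p∤w F (<⇒≤ v<F)) ⟩
      v + L                                   ∎
      where open ≡-Reasoning
    1+N!≡ : suc N ! ≡ p ^ legendreSum p F (suc N) * (w * u)
    1+N!≡ = begin
      suc N * N !               ≡⟨ cong₂ _*_ 1+N≡p^v*w N!≡p^L*u ⟩
      p ^ v * w * (p ^ L * u)   ≡⟨ interchange (p ^ v) w (p ^ L) u ⟩
      p ^ v * p ^ L * (w * u)   ≡⟨ cong (_* (w * u)) (^-distribˡ-+-* p v L) ⟨
      p ^ (v + L) * (w * u)     ≡⟨ cong (λ z → p ^ z * (w * u)) legendreSum-suc ⟨
      p ^ legendreSum p F (suc N) * (w * u) ∎
      where
      open ≡-Reasoning
    p∤w*u : ¬ p ∣ w * u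
    p∤w*u p∣w*u with euclidsLemma w u p-prime p∣w*u
    ... | inj₁ p∣w = p∤w p∣w
    ... | inj₂ p∣u = p∤u p∣u

  ^∣⇒exponent-≤ : ∀ {X a c U u e} → X * (p ^ a * U) ≡ p ^ c * u → ¬ p ∣ u → p ^ e ∣ X → e + a ≤ c
  ^∣⇒exponent-≤ {X} {a} {c} {U} {u} {e} eq p∤u p^e∣X = p^∣p^*u⇒≤ (subst (p ^ (e + a) ∣_) eq p^[e+a]∣lhs) p∤u
    where
    p^[e+a]∣lhs : p ^ (e + a) ∣ X * (p ^ a * U)
    p^[e+a]∣lhs = subst (_∣ X * (p ^ a * U)) (sym (^-distribˡ-+-* p e a)) (*-pres-∣ p^e∣X (m∣m*n U))

  exponent-<⇒∣ : ∀ {X a c U u} → X * (p ^ a * U) ≡ p ^ c * u → ¬ p ∣ U → a < c → p ∣ X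
  exponent-<⇒∣ {X} {a} {c} {U} {u} eq p∤U a<c with m≤n⇒∃[o]m+o≡n a<c
  ... | d , refl with euclidsLemma X U p-prime (divides (p ^ d * u) X*U≡)
    where
    X*U≡ : X * U ≡ p ^ d * u * p
    X*U≡ = *-cancelˡ-≡ (X * U) (p ^ d * u * p) (p ^ a) {{m^n≢0 p a}} (begin
      p ^ a * (X * U)             ≡⟨ x∙yz≈y∙xz (p ^ a) X U ⟩
      X * (p ^ a * U)             ≡⟨ eq ⟩
      p * p ^ (a + d) * u         ≡⟨ cong (λ z → p * z * u) (^-distribˡ-+-* p a d) ⟩
      p * (p ^ a * p ^ d) * u     ≡⟨ regroup p (p ^ a) (p ^ d) u ⟩
      p ^ a * (p ^ d * u * p)     ∎)
      where
      open ≡-Reasoning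
      regroup : ∀ p a d u → p * (a * d) * u ≡ a * (d * u * p)
      regroup = solve-∀
  ... | inj₁ p∣X = p∣X
  ... | inj₂ p∣U = contradiction p∣U p∤U

  binom-legendre : ∀ F k l → k + l < p ^ F →
    ∃[ U ] ∃[ u ] binom k l * (p ^ (legendreSum p F k + legendreSum p F l) * U) ≡ p ^ legendreSum p F (k + l) * u
                  × ¬ p ∣ U × ¬ p ∣ u
  binom-legendre F k l k+l<p^F
    with legendre F k (≤-<-trans (m≤m+n k l) k+l<p^F)
       | legendre F l (≤-<-trans (m≤n+m l k) k+l<p^F)
       | legendre F (k + l) k+l<p^F
  ... | u₁ , k!≡ , p∤u₁ | u₂ , l!≡ , p∤u₂ | u , [k+l]!≡ , p∤u = u₁ * u₂ , u , eq , p∤u₁*u₂ , p∤u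
    where
    a = legendreSum p F k
    b = legendreSum p F l
    eq : binom k l * (p ^ (a + b) * (u₁ * u₂)) ≡ p ^ legendreSum p F (k + l) * u
    eq = begin
      binom k l * (p ^ (a + b) * (u₁ * u₂))       ≡⟨ cong (λ z → binom k l * (z * (u₁ * u₂))) (^-distribˡ-+-* p a b) ⟩
      binom k l * (p ^ a * p ^ b * (u₁ * u₂))     ≡⟨ cong (binom k l *_) (interchange (p ^ a) (p ^ b) u₁ u₂) ⟩
      binom k l * (p ^ a * u₁ * (p ^ b * u₂))     ≡⟨ cong₂ (λ x y → binom k l * (x * y)) k!≡ l!≡ ⟨
      binom k l * (k ! * l !)                     ≡⟨ binom-! k l ⟩
      (k + l) !                                   ≡⟨ [k+l]!≡ ⟩
      p ^ legendreSum p F (k + l) * u             ∎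
      where
      open ≡-Reasoning
    p∤u₁*u₂ : ¬ p ∣ u₁ * u₂
    p∤u₁*u₂ p∣u₁*u₂ with euclidsLemma u₁ u₂ p-prime p∣u₁*u₂
    ... | inj₁ p∣u₁ = p∤u₁ p∣u₁
    ... | inj₂ p∣u₂ = p∤u₂ p∣u₂

  p^∣binom⇒legendre-≤ : ∀ F k l e → k + l < p ^ F → p ^ e ∣ binom k l →
                        e + (legendreSum p F k + legendreSum p F l) ≤ legendreSum p F (k + l)
  p^∣binom⇒legendre-≤ F k l e k+l<p^F p^e∣binom with binom-legendre F k l k+l<p^F
  ... | _ , _ , eq , _ , p∤u = ^∣⇒exponent-≤ {a = legendreSum p F k + legendreSum p F l} {e = e} eq p∤u p^e∣binom

  legendre-<⇒p∣binom : ∀ F k l → k + l < p ^ F →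
                       legendreSum p F k + legendreSum p F l < legendreSum p F (k + l) → p ∣ binom k l
  legendre-<⇒p∣binom F k l k+l<p^F gap with binom-legendre F k l k+l<p^F
  ... | _ , _ , eq , p∤U , _ = exponent-<⇒∣ {a = legendreSum p F k + legendreSum p F l} eq p∤U gap

  p^#powers≤ : ∀ F N → 0 < N → p ^ sumTo F (λ j → 𝟙 (p ^ j ≤? N)) ≤ N
  p^#powers≤ zero    N 0<N = 0<N
  p^#powers≤ (suc F) N 0<N with p ^ suc F ≤? N
  ... | yes p^[1+F]≤N = ≤-trans (^-monoʳ-≤ p (s≤s (sumTo-≤-length F _ (λ j → 𝟙≤1 (p ^ j ≤? N))))) p^[1+F]≤N
  ... | no  _         = p^#powers≤ F N 0<N

  p^∣binom⇒p^≤ : ∀ k l e → 0 < k + l → p ^ e ∣ binom k l → p ^ e ≤ k + l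
  p^∣binom⇒p^≤ k l e 0<k+l p^e∣binom = ≤-trans (^-monoʳ-≤ p e≤S) (p^#powers≤ F (k + l) 0<k+l)
    where
    F = k + l
    a = legendreSum p F k
    b = legendreSum p F l
    S = sumTo F (λ j → 𝟙 (p ^ j ≤? k + l))
    upper : legendreSum p F (k + l) ≤ a + b + S
    upper = ≤-trans (sumTo-mono-≤ F (λ j → ⌊+/⌋≤-𝟙 k l (p ^ j) {{m^n≢0 p j}}))
                    (≤-reflexive (trans (sumTo-+ F _ _) (cong (_+ S) (sumTo-+ F _ _))))
    e≤S : e ≤ S
    e≤S = +-cancelʳ-≤ (a + b) e S (subst (e + (a + b) ≤_) (+-comm (a + b) S)
            (≤-trans (p^∣binom⇒legendre-≤ F k l e (n<m^n prime>1 F) p^e∣binom) upper))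

  legendreSum-≡⌊/⌋ : ∀ F N → N < p * p → legendreSum p (suc F) N ≡ ⌊ N / p ⌋
  legendreSum-≡⌊/⌋ zero    N _     = trans (+-identityʳ _) (cong (λ q → ⌊ N / q ⌋) (*-identityʳ p))
  legendreSum-≡⌊/⌋ (suc F) N N<p*p = cong₂ _+_ (⌊/⌋≡0 {{m^n≢0 p (2 + F)}} (<-≤-trans N<p*p p*p≤p^[2+F]))
                                              (legendreSum-≡⌊/⌋ F N N<p*p)
    where
    p*p≤p^[2+F] : p * p ≤ p ^ (2 + F)
    p*p≤p^[2+F] = *-monoʳ-≤ p (m≤m*n p (p ^ F) {{m^n≢0 p F}})

  private
    legendreSum-≡⌊/⌋-binom : ∀ k l → k + l < p * p → ∀ {x} → x ≤ k + l → legendreSum p (suc (k + l)) x ≡ ⌊ x / p ⌋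
    legendreSum-≡⌊/⌋-binom k l k+l<p*p x≤k+l = legendreSum-≡⌊/⌋ (k + l) _ (≤-<-trans x≤k+l k+l<p*p)

    k+l<p^[1+k+l] : ∀ k l → k + l < p ^ suc (k + l)
    k+l<p^[1+k+l] k l = <-trans (n<1+n (k + l)) (n<m^n prime>1 (suc (k + l)))

  p^∣binom⇒⌊/⌋-≤ : ∀ k l e → k + l < p * p → p ^ e ∣ binom k l → e + (⌊ k / p ⌋ + ⌊ l / p ⌋) ≤ ⌊ k + l / p ⌋
  p^∣binom⇒⌊/⌋-≤ k l e k+l<p*p p^e∣binom =
    subst₂ (λ a b → e + a ≤ b)
      (cong₂ _+_ (ν≡⌊/⌋ (m≤m+n k l)) (ν≡⌊/⌋ (m≤n+m l k))) (ν≡⌊/⌋ ≤-refl)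
      (p^∣binom⇒legendre-≤ (suc (k + l)) k l e (k+l<p^[1+k+l] k l) p^e∣binom)
    where ν≡⌊/⌋ = legendreSum-≡⌊/⌋-binom k l k+l<p*p

  ⌊/⌋-<⇒p∣binom : ∀ k l → k + l < p * p → ⌊ k / p ⌋ + ⌊ l / p ⌋ < ⌊ k + l / p ⌋ → p ∣ binom k l
  ⌊/⌋-<⇒p∣binom k l k+l<p*p gap =
    legendre-<⇒p∣binom (suc (k + l)) k l (k+l<p^[1+k+l] k l)
      (subst₂ _<_ (sym (cong₂ _+_ (ν≡⌊/⌋ (m≤m+n k l)) (ν≡⌊/⌋ (m≤n+m l k)))) (sym (ν≡⌊/⌋ ≤-refl)) gap)
    where ν≡⌊/⌋ = legendreSum-≡⌊/⌋-binom k l k+l<p*p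

  p^∣binom⇒≤1 : ∀ k l e → k + l < p * p → p ^ e ∣ binom k l → e ≤ 1
  p^∣binom⇒≤1 k l e k+l<p*p p^e∣binom =
    +-cancelʳ-≤ (⌊ k / p ⌋ + ⌊ l / p ⌋) e 1 (≤-trans (p^∣binom⇒⌊/⌋-≤ k l e k+l<p*p p^e∣binom) (⌊+/⌋≤ k l p))

binom≤2^ : ∀ k l → binom k (suc l) ≤ 2 ^ (k + l)
binom≤2^ zero    l = m^n>0 2 l
binom≤2^ (suc k) l = ≤-trans (+-mono-≤ (binom≤2^ k l) (right l)) (≤-reflexive (cong (2 ^ (k + l) +_) (sym (+-identityʳ _))))
  where
  right : ∀ l → binom (suc k) l ≤ 2 ^ (k + l)
  right zero     = m^n>0 2 (k + 0)
  right (suc l′) = subst (λ z → binom (suc k) (suc l′) ≤ 2 ^ z) (sym (+-suc k l′)) (binom≤2^ (suc k) l′)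

binom-central≤4^ : ∀ j → binom j (suc j) ≤ 4 ^ j
binom-central≤4^ j = ≤-trans (binom≤2^ j j)
  (≤-reflexive (trans (^-distribˡ-+-* 2 j j) (sym (^-distribʳ-* 2 2 j))))

q∣q! : ∀ {q} .{{_ : NonZero q}} → q ∣ q !
q∣q! {suc q} = divides (q !) (*-comm (suc q) (q !))

prime∤! : ∀ {q} → Prime q → ∀ n → n < q → ¬ q ∣ n !
prime∤! q-prime zero    _   q∣1     = prime∤1 q-prime q∣1
prime∤! q-prime (suc n) n<q q∣[1+n]! with euclidsLemma (suc n) (n !) q-prime q∣[1+n]!
... | inj₁ q∣1+n = <⇒≱ n<q (∣⇒≤ q∣1+n)
... | inj₂ q∣n!  = prime∤! q-prime n (<-trans (n<1+n n) n<q) q∣n!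

prime∣binom : ∀ {q} → Prime q → ∀ k l → k < q → l < q → q ≤ k + l → q ∣ binom k l
prime∣binom {q} q-prime k l k<q l<q q≤k+l
  with euclidsLemma (binom k l) (k ! * l !) q-prime q∣binom*k!*l!
  where
  instance _ = prime⇒nonZero q-prime
  q∣binom*k!*l! : q ∣ binom k l * (k ! * l !)
  q∣binom*k!*l! = subst (q ∣_) (sym (binom-! k l)) (∣-trans q∣q! (m≤n⇒m!∣n! q≤k+l))
... | inj₁ q∣binom = q∣binom
... | inj₂ q∣k!*l! with euclidsLemma (k !) (l !) q-prime q∣k!*l!
...   | inj₁ q∣k! = contradiction q∣k! (prime∤! q-prime k k<q)
...   | inj₂ q∣l! = contradiction q∣l! (prime∤! q-prime l l<q)

primeProduct : ℕ → ℕ → ℕ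
primeProduct a zero    = 1
primeProduct a (suc n) with prime? (suc n) | a <? suc n
... | yes _ | yes _ = suc n * primeProduct a n
... | _     | _     = primeProduct a n

primorial : ℕ → ℕ
primorial = primeProduct 0

primeProduct-≡1 : ∀ a n → n ≤ a → primeProduct a n ≡ 1
primeProduct-≡1 a zero    _     = refl
primeProduct-≡1 a (suc n) 1+n≤a with prime? (suc n) | a <? suc n
... | yes _ | yes a<1+n = contradiction 1+n≤a (<⇒≱ a<1+n)
... | yes _ | no _      = primeProduct-≡1 a n (≤-trans (n≤1+n n) 1+n≤a)
... | no _  | _         = primeProduct-≡1 a n (≤-trans (n≤1+n n) 1+n≤a)

primeProduct-split : ∀ a b n → a ≤ b → b ≤ n → primeProduct a n ≡ primeProduct a b * primeProduct b n
primeProduct-split a b n a≤b b≤n with m≤n⇒m<n∨m≡n b≤n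
... | inj₂ refl = sym (trans (cong (primeProduct a b *_) (primeProduct-≡1 b b ≤-refl)) (*-identityʳ _))
primeProduct-split a b (suc n) a≤b _ | inj₁ b<1+n
  with prime? (suc n) | a <? suc n | b <? suc n | primeProduct-split a b n a≤b (s≤s⁻¹ b<1+n)
... | yes _ | yes _   | yes _   | IH = trans (cong (suc n *_) IH) (x∙yz≈y∙xz (suc n) (primeProduct a b) (primeProduct b n))
... | yes _ | no a≮1+n | _      | _  = contradiction (≤-<-trans a≤b b<1+n) a≮1+n
... | yes _ | _       | no b≮1+n | _ = contradiction b<1+n b≮1+n
... | no _  | _       | _       | IH = IH

primeProduct-¬prime : ∀ a n → ¬ Prime (suc n) → primeProduct a (suc n) ≡ primeProduct a n
primeProduct-¬prime a n ¬prime with prime? (suc n)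
... | yes 1+n-prime = contradiction 1+n-prime ¬prime
... | no _          = refl

primeProduct>0 : ∀ a n → 0 < primeProduct a n
primeProduct>0 a zero    = z<s
primeProduct>0 a (suc n) with prime? (suc n) | a <? suc n
... | yes _ | yes _ = *-mono-< (z<s {n}) (primeProduct>0 a n)
... | yes _ | no _  = primeProduct>0 a n
... | no _  | _     = primeProduct>0 a n

prime∣primeProduct : ∀ {p} → Prime p → ∀ a n → a < p → p ≤ n → p ∣ primeProduct a n
prime∣primeProduct p-prime a zero    _   p≤0 = contradiction (≤-trans (prime>1 p-prime) p≤0) λ ()
prime∣primeProduct {p} p-prime a (suc n) a<p p≤1+n with prime? (suc n) | a <? suc n | m≤n⇒m<n∨m≡n p≤1+n
... | yes _ | yes _   | inj₂ refl = m∣m*n _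
... | yes _ | yes _   | inj₁ p<1+n = ∣n⇒∣m*n (suc n) (prime∣primeProduct p-prime a n a<p (s≤s⁻¹ p<1+n))
... | yes _ | no a≮p  | inj₂ refl = contradiction a<p a≮p
... | no ¬prime | _   | inj₂ refl = contradiction p-prime ¬prime
... | yes _ | no _    | inj₁ p<1+n = prime∣primeProduct p-prime a n a<p (s≤s⁻¹ p<1+n)
... | no _  | _       | inj₁ p<1+n = prime∣primeProduct p-prime a n a<p (s≤s⁻¹ p<1+n)

prime∤primeProduct : ∀ {q} → Prime q → ∀ a n → n < q → ¬ q ∣ primeProduct a n
prime∤primeProduct q-prime a zero    _   q∣1 = prime∤1 q-prime q∣1
prime∤primeProduct q-prime a (suc n) n<q q∣Π with prime? (suc n) | a <? suc n
... | yes _ | yes _ with euclidsLemma (suc n) (primeProduct a n) q-prime q∣Π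
...   | inj₁ q∣1+n = <⇒≱ n<q (∣⇒≤ q∣1+n)
...   | inj₂ q∣Π′  = prime∤primeProduct q-prime a n (<-trans (n<1+n n) n<q) q∣Π′
prime∤primeProduct q-prime a (suc n) n<q q∣Π | yes _ | no _ = prime∤primeProduct q-prime a n (<-trans (n<1+n n) n<q) q∣Π
prime∤primeProduct q-prime a (suc n) n<q q∣Π | no _  | _    = prime∤primeProduct q-prime a n (<-trans (n<1+n n) n<q) q∣Π

prime*-∣ : ∀ {q Y X} → Prime q → ¬ q ∣ Y → q ∣ X → Y ∣ X → q * Y ∣ X
prime*-∣ {q} {Y} q-prime q∤Y q∣X (divides c X≡c*Y) with euclidsLemma c Y q-prime (subst (q ∣_) X≡c*Y q∣X)
... | inj₂ q∣Y = contradiction q∣Y q∤Y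
... | inj₁ (divides d c≡d*q) = divides d (trans X≡c*Y (trans (cong (_* Y) c≡d*q) (*-assoc d q Y)))

primeProduct-∣ : ∀ a n X → (∀ q → Prime q → a < q → q ≤ n → q ∣ X) → primeProduct a n ∣ X
primeProduct-∣ a zero    X _ = 1∣ X
primeProduct-∣ a (suc n) X primes∣X
  with prime? (suc n) | a <? suc n | primeProduct-∣ a n X (λ q q-prime a<q q≤n → primes∣X q q-prime a<q (m≤n⇒m≤1+n q≤n))
... | yes 1+n-prime | yes a<1+n | Π∣X =
  prime*-∣ 1+n-prime (prime∤primeProduct 1+n-prime a n (n<1+n n)) (primes∣X (suc n) 1+n-prime a<1+n ≤-refl) Π∣X
... | yes _ | no _ | Π∣X = Π∣X
... | no _  | _    | Π∣X = Π∣X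

proper-divisor⇒¬prime : ∀ {d n} → 1 < d → d < n → d ∣ n → ¬ Prime n
proper-divisor⇒¬prime {d} 1<d d<n d∣n = composite⇒¬prime (composite {d} d<n d∣n)
  where instance _ = n>1⇒nonTrivial 1<d

primorial≤4^ : ∀ n → primorial n ≤ 4 ^ n
primorial≤4^ n = go n (<-wellFounded n)
  where
  open ≤-Reasoning
  go : ∀ n → Acc _<_ n → primorial n ≤ 4 ^ n
  go n (acc rec) with halve n
  ... | zero , inj₁ refl          = ≤-refl
  ... | suc zero , inj₁ refl      = ≤ᵇ⇒≤ (primorial 2) (4 ^ 2) tt
  ... | suc (suc i) , inj₁ refl   = begin
    primorial (suc X)   ≡⟨ primeProduct-¬prime 0 X (proper-divisor⇒¬prime ≤-refl 2<1+X (divides (2 + i) (*-comm 2 (2 + i)))) ⟩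
    primorial X         ≤⟨ go X (rec (n<1+n X)) ⟩
    4 ^ X               ≤⟨ ^-monoʳ-≤ 4 (n≤1+n X) ⟩
    4 ^ suc X           ∎
    where
    X = pred (2 * (2 + i))
    2<1+X : 2 < suc X
    2<1+X = *-monoʳ-< 2 {1} {2 + i} (s≤s (s≤s z≤n))
  ... | zero , inj₂ refl          = s≤s z≤n
  ... | suc i , inj₂ refl         = begin
    primorial N                                 ≡⟨ primeProduct-split 0 (2 + i) N z≤n (<⇒≤ 2+i<N) ⟩
    primorial (2 + i) * primeProduct (2 + i) N  ≤⟨ *-mono-≤ (go (2 + i) (rec 2+i<N)) upper-half ⟩
    4 ^ (2 + i) * 4 ^ (1 + i)                   ≡⟨ ^-distribˡ-+-* 4 (2 + i) (1 + i) ⟨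
    4 ^ (2 + i + (1 + i))                       ≡⟨ cong (4 ^_) N≡[2+i]+[1+i] ⟨
    4 ^ N                                       ∎
    where
    N = suc (2 * suc i)
    N≡[2+i]+[1+i] : N ≡ 2 + i + (1 + i)
    N≡[2+i]+[1+i] = expand i
      where
      expand : ∀ i → suc (2 * suc i) ≡ 2 + i + (1 + i)
      expand = solve-∀
    2+i<N : 2 + i < N
    2+i<N = subst (2 + i <_) (sym N≡[2+i]+[1+i]) (m<m+n (2 + i) z<s)
    upper-half : primeProduct (2 + i) N ≤ 4 ^ (1 + i)
    upper-half = ≤-trans (∣⇒≤ {{>-nonZero (binom>0 (1 + i) (2 + i))}}
      (primeProduct-∣ (2 + i) N _ λ q q-prime 2+i<q q≤N →
        prime∣binom q-prime (1 + i) (2 + i) (<-trans (n<1+n _) 2+i<q) 2+i<q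
          (subst (q ≤_) (trans N≡[2+i]+[1+i] (+-comm (2 + i) (1 + i))) q≤N)))
      (binom-central≤4^ (1 + i))

primeFactor : ∀ n .{{_ : NonTrivial n}} → ∃[ p ] Prime p × p ∣ n
primeFactor n with factorise n {{nonTrivial⇒nonZero n}}
... | record { factors = [] ; isFactorisation = n≡1 } = contradiction n≡1 (>⇒≢ (nonTrivial⇒n>1 n))
... | record { factors = p ∷ ps ; isFactorisation = n≡p*Π ; factorsPrime = p-prime ∷ _ } =
  p , p-prime , divides (product ps) (trans n≡p*Π (*-comm p (product ps)))

prime^∣p*X⇒∣X : ∀ {p q} → Prime p → Prime q → q ≢ p → ∀ e X → q ^ e ∣ p * X → q ^ e ∣ X
prime^∣p*X⇒∣X p-prime q-prime q≢p zero    X _ = 1∣ X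
prime^∣p*X⇒∣X {p} {q} p-prime q-prime q≢p (suc e) X q^[1+e]∣p*X
  with euclidsLemma p X q-prime (∣-trans (m∣m*n (q ^ e)) q^[1+e]∣p*X)
... | inj₁ q∣p = contradiction (prime⇒irreducible p-prime q∣p) [ (λ q≡1 → <⇒≢ (prime>1 q-prime) (sym q≡1)) , q≢p ]′
... | inj₂ (divides X′ X≡X′*q) = subst (q ^ suc e ∣_) (trans (*-comm q X′) (sym X≡X′*q)) (*-monoʳ-∣ q q^e∣X′)
  where
  instance _ = prime⇒nonZero q-prime
  q^e∣X′ : q ^ e ∣ X′
  q^e∣X′ = prime^∣p*X⇒∣X p-prime q-prime q≢p e X′ (*-cancelˡ-∣ q
    (subst (q * q ^ e ∣_) (trans (cong (p *_) X≡X′*q) (x∙yz≈z∙xy p X′ q)) q^[1+e]∣p*X))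

prime-powers-∣⇒∣ : ∀ C M .{{_ : NonZero C}} → (∀ p e → Prime p → p ^ e ∣ C → p ^ e ∣ M) → C ∣ M
prime-powers-∣⇒∣ C M = go C M (<-wellFounded C)
  where
  go : ∀ C M .{{_ : NonZero C}} → Acc _<_ C → (∀ p e → Prime p → p ^ e ∣ C → p ^ e ∣ M) → C ∣ M
  go (suc zero) M _ _ = 1∣ M
  go C@(suc (suc _)) M (acc rec) powers∣M with primeFactor C
  ... | p , p-prime , divides C′ C≡C′*p
    with powers∣M p 1 p-prime (subst (_∣ C) (sym (*-identityʳ p)) (divides C′ C≡C′*p))
  ... | divides M′ M≡M′*[p*1] = subst₂ _∣_ (sym C≡p*C′) (sym M≡p*M′) (*-monoʳ-∣ p C′∣M′)
    where
    instance _ = prime⇒nonZero p-prime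
    C≡p*C′ : C ≡ p * C′
    C≡p*C′ = trans C≡C′*p (*-comm C′ p)
    M≡p*M′ : M ≡ p * M′
    M≡p*M′ = trans M≡M′*[p*1] (trans (cong (M′ *_) (*-identityʳ p)) (*-comm M′ p))
    instance
      C′≢0 : NonZero C′
      C′≢0 = ≢-nonZero λ C′≡0 → ≢-nonZero⁻¹ C (trans C≡p*C′ (trans (cong (p *_) C′≡0) (*-zeroʳ p)))
    C′<C : C′ < C
    C′<C = subst (C′ <_) (sym C≡C′*p) (m<m*n C′ p (prime>1 p-prime))
    powers∣M′ : ∀ q e → Prime q → q ^ e ∣ C′ → q ^ e ∣ M′
    powers∣M′ q e q-prime q^e∣C′ with q ≟ p
    ... | yes refl = *-cancelˡ-∣ p (subst (p ^ suc e ∣_) M≡p*M′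
                       (powers∣M p (suc e) p-prime (subst (p ^ suc e ∣_) (sym C≡p*C′) (*-monoʳ-∣ p q^e∣C′))))
    ... | no q≢p = prime^∣p*X⇒∣X p-prime q-prime q≢p e M′ (subst (q ^ e ∣_) M≡p*M′
                       (powers∣M q e q-prime (∣-trans q^e∣C′ (subst (C′ ∣_) (sym C≡p*C′) (n∣m*n p)))))
    C′∣M′ : C′ ∣ M′
    C′∣M′ = go C′ M′ (rec C′<C) powers∣M′

-- Erdős' argument for C(3k, k)

module _ {k m : ℕ} (2m≤k : 2 * m ≤ k) (k≤1+2m : k ≤ suc (2 * m)) where
  private
    3k≤1+2[k+m] : 3 * k ≤ suc (2 * (k + m))
    3k≤1+2[k+m] = subst₂ _≤_ (sym (3k≡2k+k k)) (expand k m) (+-monoʳ-≤ (2 * k) k≤1+2m)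
      where
      3k≡2k+k : ∀ k → 3 * k ≡ 2 * k + k
      3k≡2k+k = solve-∀
      expand : ∀ k m → 2 * k + suc (2 * m) ≡ suc (2 * (k + m))
      expand = solve-∀

    k+m≤3k : k + m ≤ 3 * k
    k+m≤3k = +-monoʳ-≤ k (≤-trans (m≤m+n m (m + 0)) (≤-trans 2m≤k (m≤m+n k (k + 0))))

  module _ {p : ℕ} (p-prime : Prime p) (3k<p*p : 3 * k < p * p) (p∣binom : p ∣ binom k (2 * k)) where
    private instance
      p≢0 : NonZero p
      p≢0 = prime⇒nonZero p-prime

    ⌊/⌋-gap : suc (⌊ k / p ⌋ + ⌊ 2 * k / p ⌋) ≤ ⌊ 3 * k / p ⌋
    ⌊/⌋-gap = p^∣binom⇒⌊/⌋-≤ p-prime k (2 * k) 1 3k<p*p (subst (_∣ binom k (2 * k)) (sym (*-identityʳ p)) p∣binom)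

    middle-prime∣binom[k+m,k] : k < 2 * p → 2 * p ≤ 3 * k → p ∣ binom k m
    middle-prime∣binom[k+m,k] k<2p 2p≤3k = ⌊/⌋-<⇒p∣binom p-prime k m (≤-<-trans k+m≤3k 3k<p*p) gap
      where
      ⌊m/p⌋≡0 : ⌊ m / p ⌋ ≡ 0
      ⌊m/p⌋≡0 = ⌊/⌋≡0 (*-cancelˡ-< 2 m p (≤-<-trans 2m≤k k<2p))
      gap : ⌊ k / p ⌋ + ⌊ m / p ⌋ < ⌊ k + m / p ⌋
      gap with k <? p
      ... | yes k<p rewrite ⌊/⌋≡0 k<p | ⌊m/p⌋≡0 =
        ⌊/⌋>0 {k + m} (2*-half (≤-trans 2p≤3k 3k≤1+2[k+m]))
      ... | no k≮p rewrite ⌊m/p⌋≡0 = begin-strict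
        ⌊ k / p ⌋ + 0   ≡⟨ +-identityʳ _ ⟩
        ⌊ k / p ⌋       ≤⟨ ⌊/⌋≤ {1} k<2p ⟩
        1               <⟨ s≤s (s≤s z≤n) ⟩
        2               ≤⟨ ≤⌊/⌋ {2} {k + m} (2*-half (≤-trans 4p≤3k 3k≤1+2[k+m])) ⟩
        ⌊ k + m / p ⌋   ∎
        where
        open ≤-Reasoning
        p≤k = ≮⇒≥ k≮p
        4≤⌊3k/p⌋ : 4 ≤ ⌊ 3 * k / p ⌋
        4≤⌊3k/p⌋ = ≤-trans (s≤s (+-mono-≤ (⌊/⌋>0 p≤k)
                                          (≤⌊/⌋ {2} (*-monoʳ-≤ 2 p≤k)))) ⌊/⌋-gap
        4p≤3k : 2 * (2 * p) ≤ 3 * k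
        4p≤3k = ≤-trans (≤-reflexive (sym (*-assoc 2 2 p))) (≤-trans (*-monoˡ-≤ p 4≤⌊3k/p⌋) (proj₁ (⌊/⌋-spec (3 * k) p)))

    -- Here p divides C(3k, k) exactly ⌊3k/p⌋ − ⌊k/p⌋ − ⌊2k/p⌋ ≤ 1 times; split on the position of p.
    large-prime∣binom[3k,k] : p ∣ primorial m * (binom k m * suc (2 * k)) ⊎ (suc (2 * k) < p × p ≤ 3 * k)
    large-prime∣binom[3k,k] with 2 * p ≤? k
    ... | yes 2p≤k = inj₁ (∣m⇒∣m*n _ (prime∣primeProduct p-prime 0 m (≤-trans z<s (prime>1 p-prime))
                                        (2*-half (≤-trans 2p≤k k≤1+2m))))
    ... | no 2p≰k with 2 * p ≤? 3 * k
    ...   | yes 2p≤3k = inj₁ (∣n⇒∣m*n (primorial m) (∣m⇒∣m*n (suc (2 * k)) (middle-prime∣binom[k+m,k] (≰⇒> 2p≰k) 2p≤3k)))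
    ...   | no 2p≰3k with p ≤? 2 * k
    ...     | yes p≤2k = contradiction ⌊2k/p⌋≤0 (<⇒≱ (⌊/⌋>0 p≤2k))
      where
      ⌊2k/p⌋≤0 : ⌊ 2 * k / p ⌋ ≤ 0
      ⌊2k/p⌋≤0 = s≤s⁻¹ (≤-trans (s≤s (m≤n+m _ ⌊ k / p ⌋)) (≤-trans ⌊/⌋-gap (⌊/⌋≤ {1} (≰⇒> 2p≰3k))))
    ...     | no p≰2k with p ≟ suc (2 * k)
    ...       | yes refl = inj₁ (∣n⇒∣m*n (primorial m) (∣n⇒∣m*n (binom k m) ∣-refl))
    ...       | no p≢1+2k with p ≤? 3 * k
    ...         | yes p≤3k = inj₂ (≤∧≢⇒< (≰⇒> p≰2k) (≢-sym p≢1+2k) , p≤3k)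
    ...         | no p≰3k = contradiction (subst (suc (⌊ k / p ⌋ + ⌊ 2 * k / p ⌋) ≤_) (⌊/⌋≡0 (≰⇒> p≰3k)) ⌊/⌋-gap) λ ()

  binom[3k,k]∣ : ∀ {T L} → 0 < k → 3 * k < T * T → 3 * k < 2 ^ L →
                 (∀ p → Prime p → suc (2 * k) < p → p ≤ 3 * k → ⊥) →
                 binom k (2 * k) ∣ (T !) ^ L * (primorial m * (binom k m * suc (2 * k)))
  binom[3k,k]∣ {T} {L} 0<k 3k<T*T 3k<2^L no-prime =
    prime-powers-∣⇒∣ _ _ {{>-nonZero (binom>0 k (2 * k))}} prime-power∣
    where
    M = (T !) ^ L * (primorial m * (binom k m * suc (2 * k)))

    small-prime-power∣ : ∀ p e → Prime p → p ≤ T → p ^ e ∣ binom k (2 * k) → p ^ e ∣ M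
    small-prime-power∣ p e p-prime p≤T p^e∣binom =
      ∣m⇒∣m*n _ (∣-trans (^-monoˡ-∣ e (∣-trans q∣q! (m≤n⇒m!∣n! p≤T))) (^-monoʳ-∣ (T !) (<⇒≤ e<L)))
      where
      instance _ = prime⇒nonZero p-prime
      p^e≤3k : p ^ e ≤ 3 * k
      p^e≤3k = p^∣binom⇒p^≤ p-prime k (2 * k) e (≤-trans 0<k (m≤m+n k (2 * k))) p^e∣binom
      e<L : e < L
      e<L = ≰⇒> λ L≤e → <⇒≱ 3k<2^L
              (≤-trans (^-monoʳ-≤ 2 L≤e) (≤-trans (^-monoˡ-≤ e (prime>1 p-prime)) p^e≤3k))

    3k<p*p : ∀ {p} → T < p → 3 * k < p * p
    3k<p*p T<p = <-≤-trans 3k<T*T (*-mono-≤ (<⇒≤ T<p) (<⇒≤ T<p))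

    large-prime-power∣ : ∀ p e → Prime p → T < p → p ^ e ∣ binom k (2 * k) → p ^ e ∣ M
    large-prime-power∣ p e p-prime T<p p^e∣binom
      with p^∣binom⇒≤1 p-prime k (2 * k) e (3k<p*p T<p) p^e∣binom
    ... | z≤n     = 1∣ M
    ... | s≤s z≤n with large-prime∣binom[3k,k] p-prime (3k<p*p T<p) (subst (_∣ binom k (2 * k)) (*-identityʳ p) p^e∣binom)
    ...   | inj₁ p∣M′            = subst (_∣ M) (sym (*-identityʳ p)) (∣n⇒∣m*n ((T !) ^ L) p∣M′)
    ...   | inj₂ (1+2k<p , p≤3k) = ⊥-elim (no-prime p p-prime 1+2k<p p≤3k)

    prime-power∣ : ∀ p e → Prime p → p ^ e ∣ binom k (2 * k) → p ^ e ∣ M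
    prime-power∣ p e p-prime with p ≤? T
    ... | yes p≤T = small-prime-power∣ p e p-prime p≤T
    ... | no  p≰T = large-prime-power∣ p e p-prime (≰⇒> p≰T)

n!≤n^n : ∀ n → n ! ≤ n ^ n
n!≤n^n zero    = ≤-refl
n!≤n^n (suc n) = *-monoʳ-≤ (suc n) (≤-trans (n!≤n^n n) (^-monoˡ-≤ n (n≤1+n n)))

binom*2^≤3^ : ∀ k l → binom k l * 2 ^ k ≤ 3 ^ (k + l)
binom*2^≤3^ zero    l       = m^n>0 3 l
binom*2^≤3^ (suc k) zero    = subst (λ z → 2 ^ suc k + 0 ≤ 3 ^ z) (sym (+-identityʳ (suc k)))
                                (≤-trans (≤-reflexive (+-identityʳ _)) (^-monoˡ-≤ (suc k) (n≤1+n 2)))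
binom*2^≤3^ (suc k) (suc l) = begin
  (A + B) * 2 ^ suc k                      ≡⟨ distrib A B (2 ^ k) ⟩
  2 * (A * 2 ^ k) + B * 2 ^ suc k          ≤⟨ +-mono-≤ (*-monoʳ-≤ 2 (binom*2^≤3^ k (suc l))) (binom*2^≤3^ (suc k) l) ⟩
  2 * 3 ^ (k + suc l) + 3 ^ (suc k + l)    ≡⟨ cong (λ z → 2 * 3 ^ (k + suc l) + 3 ^ z) (sym (+-suc k l)) ⟩
  2 * 3 ^ (k + suc l) + 3 ^ (k + suc l)    ≡⟨ twice+once (3 ^ (k + suc l)) ⟩
  3 ^ (suc k + suc l)                      ∎
  where
  open ≤-Reasoning
  A = binom k (suc l)
  B = binom (suc k) l
  distrib : ∀ A B x → (A + B) * (2 * x) ≡ 2 * (A * x) + B * (2 * x)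
  distrib = solve-∀
  twice+once : ∀ x → 2 * x + x ≡ 3 * x
  twice+once = solve-∀

binom[3k,k]-step : ∀ k → binom (suc k) (2 * suc k) * (suc k * (suc (suc (2 * k)) * suc (2 * k)))
                       ≡ binom k (2 * k) * (3 + 3 * k) * (2 + 3 * k) * (1 + 3 * k)
binom[3k,k]-step k = *-cancelʳ-≡ _ _ (k ! * (2 * k) !) {{m*n≢0 (k !) ((2 * k) !) {{k !≢0}} {{(2 * k) !≢0}}}} (begin
  c′ * (suc k * (suc (suc (2 * k)) * suc (2 * k))) * (k ! * (2 * k) !)
    ≡⟨ regroup c′ (suc k) (suc (suc (2 * k))) (suc (2 * k)) (k !) ((2 * k) !) ⟩
  c′ * (suc k ! * suc (suc (2 * k)) !)
    ≡⟨ cong (λ z → c′ * (suc k ! * z !)) (2[1+k]≡2+2k k) ⟨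
  c′ * (suc k ! * (2 * suc k) !)
    ≡⟨ binom-! (suc k) (2 * suc k) ⟩
  (suc k + 2 * suc k) !
    ≡⟨ cong _! ([1+k]+2[1+k]≡3+[k+2k] k) ⟩
  (3 + 3 * k) * ((2 + 3 * k) * ((1 + 3 * k) * (k + 2 * k) !))
    ≡⟨ cong (λ z → (3 + 3 * k) * ((2 + 3 * k) * ((1 + 3 * k) * z))) (binom-! k (2 * k)) ⟨
  (3 + 3 * k) * ((2 + 3 * k) * ((1 + 3 * k) * (c * (k ! * (2 * k) !))))
    ≡⟨ regroup′ (3 + 3 * k) (2 + 3 * k) (1 + 3 * k) c (k ! * (2 * k) !) ⟩
  c * (3 + 3 * k) * (2 + 3 * k) * (1 + 3 * k) * (k ! * (2 * k) !) ∎)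
  where
  open ≡-Reasoning
  c  = binom k (2 * k)
  c′ = binom (suc k) (2 * suc k)
  regroup : ∀ c a b d x y → c * (a * (b * d)) * (x * y) ≡ c * ((a * x) * (b * (d * y)))
  regroup = solve-∀
  regroup′ : ∀ a b d c D → a * (b * (d * (c * D))) ≡ c * a * b * d * D
  regroup′ = solve-∀
  2[1+k]≡2+2k : ∀ k → 2 * suc k ≡ suc (suc (2 * k))
  2[1+k]≡2+2k = solve-∀
  [1+k]+2[1+k]≡3+[k+2k] : ∀ k → suc k + 2 * suc k ≡ suc (suc (suc (k + 2 * k)))
  [1+k]+2[1+k]≡3+[k+2k] = solve-∀

27^k≤binom[3k,k]*4^k*[1+3k] : ∀ k → 27 ^ k ≤ binom k (2 * k) * 4 ^ k * suc (3 * k)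
27^k≤binom[3k,k]*4^k*[1+3k] zero    = ≤-refl
27^k≤binom[3k,k]*4^k*[1+3k] (suc k) = *-cancelʳ-≤ _ _ A {{A≢0}} (begin
  27 * 27 ^ k * A                                    ≤⟨ *-monoˡ-≤ A (*-monoʳ-≤ 27 (27^k≤binom[3k,k]*4^k*[1+3k] k)) ⟩
  27 * (c * 4 ^ k * suc (3 * k)) * A                 ≡⟨ regroup₁ c (4 ^ k) (suc (3 * k)) A ⟩
  c * 4 ^ k * suc (3 * k) * (27 * A)                 ≤⟨ *-monoʳ-≤ (c * 4 ^ k * suc (3 * k)) 27A≤ ⟩
  c * 4 ^ k * suc (3 * k) * (4 * ((3 + 3 * k) * (2 + 3 * k) * (4 + 3 * k)))
                                                     ≡⟨ regroup₂ c (4 ^ k) k ⟩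
  c * (3 + 3 * k) * (2 + 3 * k) * (1 + 3 * k) * (4 * 4 ^ k) * (4 + 3 * k)
                                                     ≡⟨ cong (λ z → z * (4 * 4 ^ k) * (4 + 3 * k)) (binom[3k,k]-step k) ⟨
  c′ * A * (4 * 4 ^ k) * (4 + 3 * k)                 ≡⟨ regroup₃ c′ A (4 * 4 ^ k) k ⟩
  c′ * (4 * 4 ^ k) * suc (3 * suc k) * A             ∎)
  where
  open ≤-Reasoning
  c  = binom k (2 * k)
  c′ = binom (suc k) (2 * suc k)
  A  = suc k * (suc (suc (2 * k)) * suc (2 * k))
  A≢0 : NonZero A
  A≢0 = m*n≢0 (suc k) _
  27A≤ : 27 * A ≤ 4 * ((3 + 3 * k) * (2 + 3 * k) * (4 + 3 * k))
  27A≤ = subst (27 * A ≤_) (cubic k) (m≤m+n (27 * A) _)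
    where
    cubic : ∀ k → 27 * (suc k * (suc (suc (2 * k)) * suc (2 * k))) + suc k * (42 + 54 * k)
                ≡ 4 * ((3 + 3 * k) * (2 + 3 * k) * (4 + 3 * k))
    cubic = solve-∀
  regroup₁ : ∀ c P s A → 27 * (c * P * s) * A ≡ c * P * s * (27 * A)
  regroup₁ = solve-∀
  regroup₂ : ∀ c P k → c * P * suc (3 * k) * (4 * ((3 + 3 * k) * (2 + 3 * k) * (4 + 3 * k)))
                     ≡ c * (3 + 3 * k) * (2 + 3 * k) * (1 + 3 * k) * (4 * P) * (4 + 3 * k)
  regroup₂ = solve-∀
  regroup₃ : ∀ c A Q k → c * A * Q * (4 + 3 * k) ≡ c * Q * suc (3 * suc k) * A
  regroup₃ = solve-∀

27^k*2^k≤ : ∀ k m F → binom k (2 * k) ≤ F * (primorial m * (binom k m * suc (2 * k))) →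
            27 ^ k * 2 ^ k ≤ F * (suc (2 * k) * suc (3 * k)) * (4 ^ m * 3 ^ (k + m) * 4 ^ k)
27^k*2^k≤ k m F binom≤ = begin
  27 ^ k * 2 ^ k                               ≤⟨ *-monoˡ-≤ (2 ^ k) (27^k≤binom[3k,k]*4^k*[1+3k] k) ⟩
  binom k (2 * k) * 4 ^ k * suc (3 * k) * 2 ^ k ≤⟨ *-monoˡ-≤ (2 ^ k) (*-monoˡ-≤ (suc (3 * k)) (*-monoˡ-≤ (4 ^ k) binom≤)) ⟩
  F * (P * (B * suc (2 * k))) * 4 ^ k * suc (3 * k) * 2 ^ k
                                               ≡⟨ regroup F P B (suc (2 * k)) (suc (3 * k)) (4 ^ k) (2 ^ k) ⟩
  F * (suc (2 * k) * suc (3 * k)) * (P * (B * 2 ^ k) * 4 ^ k)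
                                               ≤⟨ *-monoʳ-≤ (F * (suc (2 * k) * suc (3 * k)))
                                                    (*-monoˡ-≤ (4 ^ k) (*-mono-≤ (primorial≤4^ m) (binom*2^≤3^ k m))) ⟩
  F * (suc (2 * k) * suc (3 * k)) * (4 ^ m * 3 ^ (k + m) * 4 ^ k) ∎
  where
  open ≤-Reasoning
  P = primorial m
  B = binom k m
  regroup : ∀ F P B s t Q R → F * (P * (B * s)) * Q * t * R ≡ F * (s * t) * (P * (B * R) * Q)
  regroup = solve-∀

private
  27^[2m]*2^[2m]≡ : ∀ m → 27 ^ (2 * m) * 2 ^ (2 * m) ≡ 108 ^ m * 27 ^ m
  27^[2m]*2^[2m]≡ m = begin
    27 ^ (2 * m) * 2 ^ (2 * m)   ≡⟨ cong₂ _*_ (^-*-assoc 27 2 m) (^-*-assoc 2 2 m) ⟨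
    729 ^ m * 4 ^ m              ≡⟨ ^-distribʳ-* 729 4 m ⟨
    2916 ^ m                     ≡⟨ ^-distribʳ-* 108 27 m ⟩
    108 ^ m * 27 ^ m             ∎
    where open ≡-Reasoning

  W*4^m*3^[3m]*16^m≡ : ∀ m W → W * (4 ^ m * 3 ^ (2 * m + m) * 4 ^ (2 * m)) ≡ 108 ^ m * (W * 16 ^ m)
  W*4^m*3^[3m]*16^m≡ m W = begin
    W * (4 ^ m * 3 ^ (2 * m + m) * 4 ^ (2 * m))  ≡⟨ cong (λ e → W * (4 ^ m * 3 ^ e * 4 ^ (2 * m))) (2m+m≡3m m) ⟩
    W * (4 ^ m * 3 ^ (3 * m) * 4 ^ (2 * m))      ≡⟨ cong₂ (λ x y → W * (4 ^ m * x * y)) (^-*-assoc 3 3 m) (^-*-assoc 4 2 m) ⟨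
    W * (4 ^ m * 27 ^ m * 16 ^ m)                ≡⟨ cong (λ x → W * (x * 16 ^ m)) (^-distribʳ-* 4 27 m) ⟨
    W * (108 ^ m * 16 ^ m)                       ≡⟨ x∙yz≈y∙xz W (108 ^ m) (16 ^ m) ⟩
    108 ^ m * (W * 16 ^ m)                       ∎
    where
    open ≡-Reasoning
    2m+m≡3m : ∀ m → 2 * m + m ≡ 3 * m
    2m+m≡3m = solve-∀

27^k*2^k≤⇒27^m≤ : ∀ k m W → k ≡ 2 * m ⊎ k ≡ suc (2 * m) →
                  27 ^ k * 2 ^ k ≤ W * (4 ^ m * 3 ^ (k + m) * 4 ^ k) → 27 ^ m ≤ W * 16 ^ m
27^k*2^k≤⇒27^m≤ k m W (inj₁ refl) ≤W =
  *-cancelˡ-≤ (108 ^ m) {{m^n≢0 108 m}} (subst₂ _≤_ (27^[2m]*2^[2m]≡ m) (W*4^m*3^[3m]*16^m≡ m W) ≤W)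
27^k*2^k≤⇒27^m≤ k m W (inj₂ refl) ≤W =
  *-cancelˡ-≤ (108 ^ m) {{m^n≢0 108 m}} (*-cancelˡ-≤ 12 (begin
    12 * (108 ^ m * 27 ^ m)                       ≤⟨ *-monoˡ-≤ (108 ^ m * 27 ^ m) (≤ᵇ⇒≤ 12 54 tt) ⟩
    54 * (108 ^ m * 27 ^ m)                       ≡⟨ cong (54 *_) (27^[2m]*2^[2m]≡ m) ⟨
    54 * (27 ^ (2 * m) * 2 ^ (2 * m))             ≡⟨ pull-54 (27 ^ (2 * m)) (2 ^ (2 * m)) ⟩
    27 ^ suc (2 * m) * 2 ^ suc (2 * m)            ≤⟨ ≤W ⟩
    W * (4 ^ m * (3 * 3 ^ (2 * m + m)) * (4 * 4 ^ (2 * m)))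
                                                  ≡⟨ pull-12 W (4 ^ m) (3 ^ (2 * m + m)) (4 ^ (2 * m)) ⟩
    12 * (W * (4 ^ m * 3 ^ (2 * m + m) * 4 ^ (2 * m))) ≡⟨ cong (12 *_) (W*4^m*3^[3m]*16^m≡ m W) ⟩
    12 * (108 ^ m * (W * 16 ^ m))                 ∎))
  where
  open ≤-Reasoning
  pull-54 : ∀ x y → 54 * (x * y) ≡ 27 * x * (2 * y)
  pull-54 = solve-∀
  pull-12 : ∀ W a b c → W * (a * (3 * b) * (4 * c)) ≡ 12 * (W * (a * b * c))
  pull-12 = solve-∀

8^[m/4]*16^m≤27^m : ∀ m → 8 ^ (m / 4) * 16 ^ m ≤ 27 ^ m
8^[m/4]*16^m≤27^m m = begin
  8 ^ q * 16 ^ m                   ≡⟨ cong (λ e → 8 ^ q * 16 ^ e) m≡r+4q ⟩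
  8 ^ q * 16 ^ (r + 4 * q)         ≡⟨ cong (8 ^ q *_) (^-distribˡ-+-* 16 r (4 * q)) ⟩
  8 ^ q * (16 ^ r * 16 ^ (4 * q))  ≡⟨ cong (λ x → 8 ^ q * (16 ^ r * x)) (^-*-assoc 16 4 q) ⟨
  8 ^ q * (16 ^ r * 65536 ^ q)     ≡⟨ x∙yz≈y∙xz (8 ^ q) (16 ^ r) (65536 ^ q) ⟩
  16 ^ r * (8 ^ q * 65536 ^ q)     ≡⟨ cong (16 ^ r *_) (^-distribʳ-* 8 65536 q) ⟨
  16 ^ r * 524288 ^ q              ≤⟨ *-mono-≤ (^-monoˡ-≤ r (≤ᵇ⇒≤ 16 27 tt)) (^-monoˡ-≤ q (≤ᵇ⇒≤ 524288 531441 tt)) ⟩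
  27 ^ r * 531441 ^ q              ≡⟨ cong (27 ^ r *_) (^-*-assoc 27 4 q) ⟩
  27 ^ r * 27 ^ (4 * q)            ≡⟨ ^-distribˡ-+-* 27 r (4 * q) ⟨
  27 ^ (r + 4 * q)                 ≡⟨ cong (27 ^_) m≡r+4q ⟨
  27 ^ m                           ∎
  where
  open ≤-Reasoning
  r = m % 4
  q = m / 4
  m≡r+4q : m ≡ r + 4 * q
  m≡r+4q = trans (m≡m%n+[m/n]*n m 4) (cong (r +_) (*-comm q 4))

-- The right-hand side (T!)^L (2k + 1)(3k + 1) of the final inequality, for T = 2^j and L = 2j.
W : ℕ → ℕ → ℕ
W j k = ((2 ^ j) !) ^ (2 * j) * (suc (2 * k) * suc (3 * k))

logW : ℕ → ℕ
logW j = j * 2 ^ j * (2 * j) + (2 * j + 2 * j)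

W≤2^logW : ∀ j k → 3 * k < 4 ^ j → W j k ≤ 2 ^ logW j
W≤2^logW j k 3k<4^j = begin
  (R !) ^ L * (suc (2 * k) * suc (3 * k))  ≤⟨ *-mono-≤ (^-monoˡ-≤ L (n!≤n^n R)) (*-mono-≤ 1+2k≤2^L 3k<2^L) ⟩
  (R ^ R) ^ L * (2 ^ L * 2 ^ L)            ≡⟨ cong (λ z → z ^ L * (2 ^ L * 2 ^ L)) (^-*-assoc 2 j R) ⟩
  (2 ^ (j * R)) ^ L * (2 ^ L * 2 ^ L)      ≡⟨ cong (_* (2 ^ L * 2 ^ L)) (^-*-assoc 2 (j * R) L) ⟩
  2 ^ (j * R * L) * (2 ^ L * 2 ^ L)        ≡⟨ cong (2 ^ (j * R * L) *_) (^-distribˡ-+-* 2 L L) ⟨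
  2 ^ (j * R * L) * 2 ^ (L + L)            ≡⟨ ^-distribˡ-+-* 2 (j * R * L) (L + L) ⟨
  2 ^ logW j                               ∎
  where
  open ≤-Reasoning
  R = 2 ^ j
  L = 2 * j
  3k<2^L : 3 * k < 2 ^ L
  3k<2^L = subst (3 * k <_) (^-*-assoc 2 2 j) 3k<4^j
  1+2k≤2^L : suc (2 * k) ≤ 2 ^ L
  1+2k≤2^L = ≤-trans (s≤s (*-monoˡ-≤ k (n≤1+n 2))) 3k<2^L

32j²+1≤2^[j-1] : ∀ t → 32 * ((14 + t) * (14 + t)) + 1 ≤ 2 ^ (13 + t)
32j²+1≤2^[j-1] zero    = ≤ᵇ⇒≤ _ _ tt
32j²+1≤2^[j-1] (suc t) = begin
  32 * ((15 + t) * (15 + t)) + 1                                        ≤⟨ m≤m+n _ _ ⟩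
  32 * ((15 + t) * (15 + t)) + 1 + (32 * ((11 + t) * (11 + t) + 4 * (11 + t) + 2) + 1)
                                                                        ≡⟨ double (11 + t) ⟨
  2 * (32 * ((14 + t) * (14 + t)) + 1)                                  ≤⟨ *-monoʳ-≤ 2 (32j²+1≤2^[j-1] t) ⟩
  2 * 2 ^ (13 + t)                                                      ∎
  where
  open ≤-Reasoning
  double : ∀ b → 2 * (32 * ((3 + b) * (3 + b)) + 1) ≡ 32 * ((4 + b) * (4 + b)) + 1 + (32 * (b * b + 4 * b + 2) + 1)
  double = solve-∀

logW<3q : ∀ t q → 4 ^ (13 + t) ≤ 24 * q + 21 → logW (14 + t) < 3 * q
logW<3q t q 4^[13+t]≤ = *-cancelˡ-< 8 (logW j) (3 * q) (+-cancelʳ-< 21 (8 * logW j) (8 * (3 * q)) (begin-strict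
  8 * logW j + 21                    ≡⟨ expand j X ⟩
  32 * (j * j) * X + (32 * j + 21)   <⟨ +-monoʳ-< (32 * (j * j) * X) 32j+21<X ⟩
  32 * (j * j) * X + X               ≡⟨ cong (32 * (j * j) * X +_) (*-identityˡ X) ⟨
  32 * (j * j) * X + 1 * X           ≡⟨ *-distribʳ-+ X (32 * (j * j)) 1 ⟨
  (32 * (j * j) + 1) * X             ≤⟨ *-monoˡ-≤ X (32j²+1≤2^[j-1] t) ⟩
  X * X                              ≡⟨ ^-distribʳ-* 2 2 (13 + t) ⟨
  4 ^ (13 + t)                       ≤⟨ 4^[13+t]≤ ⟩
  24 * q + 21                        ≡⟨ cong (_+ 21) (*-assoc 8 3 q) ⟩
  8 * (3 * q) + 21                   ∎))
  where
  open ≤-Reasoning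
  j = 14 + t
  X = 2 ^ (13 + t)
  expand : ∀ j X → 8 * (j * (2 * X) * (2 * j) + (2 * j + 2 * j)) + 21 ≡ 32 * (j * j) * X + (32 * j + 21)
  expand = solve-∀
  32j+21<32j²+1 : ∀ b → 32 * (2 + b) + 21 < 32 * ((2 + b) * (2 + b)) + 1
  32j+21<32j²+1 b = subst (32 * (2 + b) + 21 <_) (sym (spread b)) (m≤m+n _ _)
    where
    spread : ∀ b → 32 * ((2 + b) * (2 + b)) + 1 ≡ suc (32 * (2 + b) + 21) + (32 * (b * b + 3 * b) + 43)
    spread = solve-∀
  32j+21<X : 32 * j + 21 < X
  32j+21<X = <-≤-trans (32j+21<32j²+1 (12 + t)) (32j²+1≤2^[j-1] t)

module PrimeFreeInterval {k m t : ℕ} (k≡2m∨1+2m : k ≡ 2 * m ⊎ k ≡ suc (2 * m))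
                (4^[13+t]≤3k : 4 ^ (13 + t) ≤ 3 * k) (3k<4^[14+t] : 3 * k < 4 ^ (14 + t))
                (no-prime : ∀ p → Prime p → suc (2 * k) < p → p ≤ 3 * k → ⊥) where
  private
    j = 14 + t
    R = 2 ^ j
    L = 2 * j
    q = m / 4

    2m≤k : 2 * m ≤ k
    2m≤k = proj₁ (halving-bounds {k} {m} k≡2m∨1+2m)

    k≤1+2m : k ≤ suc (2 * m)
    k≤1+2m = proj₂ (halving-bounds {k} {m} k≡2m∨1+2m)

    0<k : 0 < k
    0<k = n≢0⇒n>0 λ k≡0 → <⇒≱ (m^n>0 4 (13 + t)) (subst (λ x → 4 ^ (13 + t) ≤ 3 * x) k≡0 4^[13+t]≤3k)

    instance
      M≢0 : NonZero ((R !) ^ L * (primorial m * (binom k m * suc (2 * k))))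
      M≢0 = m*n≢0 _ _ {{m^n≢0 (R !) L {{R !≢0}}}}
              {{m*n≢0 _ _ {{>-nonZero (primeProduct>0 0 m)}} {{m*n≢0 _ _ {{>-nonZero (binom>0 k m)}}}}}}

    binom[3k,k]≤ : binom k (2 * k) ≤ (R !) ^ L * (primorial m * (binom k m * suc (2 * k)))
    binom[3k,k]≤ = ∣⇒≤ (binom[3k,k]∣ {k} {m} 2m≤k k≤1+2m {R} {L} 0<k
                         (subst (3 * k <_) (^-distribʳ-* 2 2 j) 3k<4^[14+t])
                         (subst (3 * k <_) (^-*-assoc 2 2 j) 3k<4^[14+t]) no-prime)

    8^q≤W : 8 ^ q ≤ W j k
    8^q≤W = *-cancelʳ-≤ (8 ^ q) (W j k) (16 ^ m) {{m^n≢0 16 m}} (≤-trans (8^[m/4]*16^m≤27^m m)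
              (27^k*2^k≤⇒27^m≤ k m (W j k) k≡2m∨1+2m (27^k*2^k≤ k m ((R !) ^ L) binom[3k,k]≤)))

    3q≤logW : 3 * q ≤ logW j
    3q≤logW = ≮⇒≥ λ logW<3q → <⇒≱ (^-monoʳ-< 2 (s≤s (s≤s z≤n)) logW<3q)
                (≤-trans (≤-reflexive (sym (^-*-assoc 2 3 q))) (≤-trans 8^q≤W (W≤2^logW j k 3k<4^[14+t])))

    3k≤24q+21 : 3 * k ≤ 24 * q + 21
    3k≤24q+21 = ≤-trans (*-monoʳ-≤ 3 k≤1+2m) (≤-trans (*-monoʳ-≤ 3 (s≤s (*-monoʳ-≤ 2 m≤3+4q))) (≤-reflexive (expand q)))
      where
      m≤3+4q : m ≤ 3 + 4 * q
      m≤3+4q = subst (_≤ 3 + 4 * q) (sym (trans (m≡m%n+[m/n]*n m 4) (cong (m % 4 +_) (*-comm q 4))))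
                 (+-monoˡ-≤ (4 * q) (s≤s⁻¹ (m%n<n m 4)))
      expand : ∀ q → 3 * suc (2 * (3 + 4 * q)) ≡ 24 * q + 21
      expand = solve-∀

  absurd : ⊥
  absurd = <⇒≱ (logW<3q t q (≤-trans 4^[13+t]≤3k 3k≤24q+21)) 3q≤logW

¬4^[13+n]≤n : ∀ n → ¬ 4 ^ (13 + n) ≤ n
¬4^[13+n]≤n n = <⇒≱ (<-≤-trans (n<m^n (s≤s (s≤s z≤n)) n) (^-monoʳ-≤ 4 (m≤n+m n 13)))

prime-between-2k+1-and-3k : ∀ k → 4 ^ 13 ≤ 3 * k → ∃[ p ] Prime p × suc (2 * k) < p × p < 3 * k
prime-between-2k+1-and-3k k 4^13≤3k with anyUpTo? (λ p → prime? p ×-dec suc (2 * k) <? p) (3 * k)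
... | yes (p , p<3k , p-prime , 1+2k<p) = p , p-prime , 1+2k<p , p<3k
... | no ∄p = ⊥-elim (prime-free⇒⊥ (halve k) (crossing (λ t → 4 ^ (13 + t) ≤? 3 * k) 4^13≤3k (3 * k) (¬4^[13+n]≤n (3 * k))))
  where
  no-prime : ∀ p → Prime p → suc (2 * k) < p → p ≤ 3 * k → ⊥
  no-prime p p-prime 1+2k<p p≤3k with m≤n⇒m<n∨m≡n p≤3k
  ... | inj₁ p<3k = ∄p (p , p<3k , p-prime , 1+2k<p)
  ... | inj₂ refl = proper-divisor⇒¬prime {3} (s≤s (s≤s z≤n)) (≤-trans (≤ᵇ⇒≤ 4 (4 ^ 13) tt) 4^13≤3k)
                      (divides k (*-comm 3 k)) p-prime
  prime-free⇒⊥ : ∃[ m ] (k ≡ 2 * m ⊎ k ≡ suc (2 * m)) → ∃[ t ] 4 ^ (13 + t) ≤ 3 * k × ¬ 4 ^ (14 + t) ≤ 3 * k → ⊥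
  prime-free⇒⊥ (m , k≡2m∨1+2m) (t , 4^[13+t]≤3k , ¬4^[14+t]≤3k) =
    PrimeFreeInterval.absurd {k} {m} {t} k≡2m∨1+2m 4^[13+t]≤3k (≰⇒> ¬4^[14+t]≤3k) no-prime

-- Small n

trialDivision : ℕ → ℕ → ℕ → Bool
trialDivision p d zero       = false
trialDivision p d (suc fuel) with p <? d * d | d ∣? p
... | yes _ | _     = true
... | no _  | yes _ = false
... | no _  | no _  = trialDivision p (suc d) fuel

trialDivision-sound : ∀ p d fuel → T (trialDivision p d fuel) → d Rough p → ∃[ d′ ] d′ Rough p × p < d′ * d′
trialDivision-sound p d (suc fuel) ok d-rough with p <? d * d | d ∣? p
... | yes p<d*d | _   = d , d-rough , p<d*d
... | no _      | no d∤p = trialDivision-sound p (suc d) fuel ok (∤⇒rough-suc d∤p d-rough)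

isPrimeᵇ : ℕ → Bool
isPrimeᵇ p = trialDivision p 2 p

isPrimeᵇ-sound : ∀ p .{{_ : NonTrivial p}} → T (isPrimeᵇ p) → Prime p
isPrimeᵇ-sound p ok with trialDivision-sound p 2 p ok 2-rough
... | _ , d-rough , p<d*d = rough∧square>⇒prime d-rough p<d*d

ladder : ℕ → ℕ → List ℕ → Bool
ladder lo hi []       = hi ≤ᵇ lo
ladder lo hi (q ∷ qs) = (isPrimeᵇ q ∧ (lo <ᵇ q)) ∧ ((2 * q <ᵇ 3 * lo) ∧ ladder q hi qs)

ladder-sound : ∀ lo hi qs → 2 ≤ lo → T (ladder lo hi qs) →
               ∀ n → lo ≤ n → n < hi → ∃[ r ] Prime r × n < r × 2 * r < 3 * n
ladder-sound lo hi []       _    hi≤lo n lo≤n n<hi = contradiction (≤-trans (≤ᵇ⇒≤ hi lo hi≤lo) lo≤n) (<⇒≱ n<hi)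
ladder-sound lo hi (q ∷ qs) 2≤lo ok    n lo≤n n<hi with Equivalence.to T-∧ ok
... | rung-ok , rest with Equivalence.to T-∧ rung-ok | Equivalence.to T-∧ rest
...   | q-primeᵇ , lo<ᵇq | 2q<ᵇ3lo , rest-ok = next (n <? q)
  where
  2≤q : 2 ≤ q
  2≤q = ≤-trans 2≤lo (<⇒≤ (<ᵇ⇒< lo q lo<ᵇq))
  next : Dec (n < q) → ∃[ r ] Prime r × n < r × 2 * r < 3 * n
  next (yes n<q) = q , isPrimeᵇ-sound q {{n>1⇒nonTrivial 2≤q}} q-primeᵇ , n<q ,
                   <-≤-trans (<ᵇ⇒< (2 * q) (3 * lo) 2q<ᵇ3lo) (*-monoʳ-≤ 3 lo≤n)
  next (no n≮q)  = ladder-sound q hi qs 2≤q rest-ok n (≮⇒≥ n≮q) n<hi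

-- The last rung is where the argument for large n takes over: 3 · 26571245 ≥ 4^13.
primeLadder : List ℕ
primeLadder = 11 ∷ 13 ∷ 19 ∷ 23 ∷ 31 ∷ 43 ∷ 61 ∷ 89 ∷ 131 ∷ 193 ∷ 283 ∷ 421 ∷ 631 ∷ 941 ∷ 1409 ∷ 2113 ∷
              3169 ∷ 4751 ∷ 7121 ∷ 10667 ∷ 15991 ∷ 23981 ∷ 35969 ∷ 53951 ∷ 80923 ∷ 121379 ∷ 182059 ∷
              273083 ∷ 409609 ∷ 614413 ∷ 921611 ∷ 1382393 ∷ 2073563 ∷ 3110339 ∷ 4665499 ∷ 6998221 ∷
              10497299 ∷ 15745943 ∷ 23618891 ∷ 35428333 ∷ 53142491 ∷ []

prime-between-n-and-3n/2-small : ∀ n → 8 ≤ n → n < 53142491 → ∃[ r ] Prime r × n < r × 2 * r < 3 * n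
prime-between-n-and-3n/2-small = ladder-sound 8 53142491 primeLadder (s≤s (s≤s z≤n)) tt

prime-between-n-and-3n/2-large : ∀ n k → 53142491 ≤ n → 2 * k ≤ n × n ≤ suc (2 * k) →
                                 ∃[ r ] Prime r × n < r × 2 * r < 3 * n
prime-between-n-and-3n/2-large n k N₀≤n (2k≤n , n≤1+2k) = conclude (prime-between-2k+1-and-3k k 4^13≤3k)
  where
  4^13≤3k : 4 ^ 13 ≤ 3 * k
  4^13≤3k = ≤-trans (≤ᵇ⇒≤ (4 ^ 13) (3 * 26571245) tt)
              (*-monoʳ-≤ 3 (2*-half {26571245} {k} (≤-trans (≤ᵇ⇒≤ (2 * 26571245) 53142491 tt) (≤-trans N₀≤n n≤1+2k))))
  conclude : ∃[ p ] Prime p × suc (2 * k) < p × p < 3 * k → ∃[ r ] Prime r × n < r × 2 * r < 3 * n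
  conclude (p , p-prime , 1+2k<p , p<3k) =
    p , p-prime , ≤-<-trans n≤1+2k 1+2k<p , ≤-trans (*-monoʳ-< 2 p<3k) (≤-trans (≤-reflexive (swap k)) (*-monoʳ-≤ 3 2k≤n))
    where
    swap : ∀ k → 2 * (3 * k) ≡ 3 * (2 * k)
    swap k = trans (sym (*-assoc 2 3 k)) (*-assoc 3 2 k)

prime-between-n-and-3n/2 : ∀ n → 8 ≤ n → ∃[ r ] Prime r × n < r × 2 * r < 3 * n
prime-between-n-and-3n/2 n 8≤n with n <? 53142491 | halve n
... | yes n<N₀ | _             = prime-between-n-and-3n/2-small n 8≤n n<N₀
... | no  n≮N₀ | k , n≡2k∨1+2k = prime-between-n-and-3n/2-large n k (≮⇒≥ n≮N₀) (halving-bounds {n} {k} n≡2k∨1+2k)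

theorem8p4 : (m : ℕ) → 0 < m → (n : ℕ) → 0 < n → AboveThreshold m n →
    ∃₂ λ (r a : ℕ) → Prime r × 0 < a ×
      (n < r) × (2 * r < 3 * n) × (3 * n < 2 * a ^ m) × (a ^ m < 2 * n)
theorem8p4 (suc m) _ n 0<n above =
  let r , r-prime , n<r , 2r<3n    = prime-between-n-and-3n/2 n (above-threshold⇒8≤n m n above)
      b , 2b^M≤3n , ¬2[1+b]^M≤3n = crossing (λ b → 2 * b ^ suc m ≤? 3 * n) z≤n (3 * n)
                                      (<⇒≱ (n<2*n^[1+m] m (*-monoʳ-< 3 0<n)))
  in r , suc b , r-prime , z<s , n<r , 2r<3n , ≰⇒> ¬2[1+b]^M≤3n , above-threshold⇒successor-power<2n m n above b 2b^M≤3n
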